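{- Let $\Theta_1$ and $\Theta_2$ be closed IIMLL proof nets with the same conclusion such that $\Theta_1 \neq \Theta_2$. Then there is a one-hole context $C[]$ such that $C[\Theta_1[p \multimap (p \multimap p) \multimap (p \multimap p) \multimap p/p]] = \underline{0}$ and $C[\Theta_2[p \multimap (p \multimap p) \multimap (p \multimap p) \multimap p/p]] = \underline{1}$.
   Context: IMLL is intuitionistic multiplicative linear logic without the unit; formulas are built from one atom $p$ with $\otimes$ and $⅋$ (par), with polarities $+$/$-$; $(A\otimes B)^-$ and $(A⅋B)^+$ are written as linear implications $A \multimap B$. IIMLL is the implicational fragment: IIMLL proof nets are IMLL proof nets built without $\otimes^+$-links and $⅋^-$-links, so conclusions are formulas built from $p$ with $\multimap$ only. Proof nets are identified with their normal forms (cut elimination plus multiplicative $\eta$-expansion); closed means having exactly one conclusion. Equality $=$ of normal nets is the paper's equality via main paths, heads and direct subproof nets, corresponding to $\beta\eta$-equality of linear $\lambda$-terms up to renaming of free variables. A one-hole context $C[]$ is an (extended IIMLL) proof net with exactly one hole axiom of positive conclusion $A^+$; $C[\Theta]$ plugs $\Theta$ (with conclusion $A^+$) into the hole. $\Theta[A/p]$ replaces every occurrence of $p$ by $A$. $\underline{0}$ and $\underline{1}$ are the two closed normal proof nets of $p \multimap (p \multimap p) \multimap (p \multimap p) \multimap p$, corresponding to $\lambda x.\lambda f.\lambda g.\, g(f x)$ and $\lambda x.\lambda f.\lambda g.\, f(g x)$. -}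

module Defs where

-- IIMLL proof nets are represented by linear lambda-terms (Church style,
-- de Bruijn indices), with proof-net equality being beta-eta conversion.

open import Data.Nat using (ℕ; zero; suc)
open import Data.List using (List; []; _∷_)
open import Data.List.Relation.Unary.All using (All)
open import Data.Maybe using (Maybe; just; nothing)
open import Relation.Binary.PropositionalEquality using (_≡_)

infixr 30 _⊸_

data Ty : Set where
  p   : Ty
  _⊸_ : Ty → Ty → Ty

_[_/p] : Ty → Ty → Ty
p [ B /p] = B
(A₁ ⊸ A₂) [ B /p] = (A₁ [ B /p]) ⊸ (A₂ [ B /p])

data Tm : Set where
  var : ℕ → Tm
  lam : Ty → Tm → Tm
  app : Tm → Tm → Tm

tsub : Ty → Tm → Tm
tsub B (var n) = var n
tsub B (lam A t) = lam (A [ B /p]) (tsub B t)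
tsub B (app t u) = app (tsub B t) (tsub B u)

ext : (ℕ → ℕ) → ℕ → ℕ
ext ρ zero = zero
ext ρ (suc n) = suc (ρ n)

rename : (ℕ → ℕ) → Tm → Tm
rename ρ (var n) = var (ρ n)
rename ρ (lam A t) = lam A (rename (ext ρ) t)
rename ρ (app t u) = app (rename ρ t) (rename ρ u)

exts : (ℕ → Tm) → ℕ → Tm
exts σ zero = var zero
exts σ (suc n) = rename suc (σ n)

subst : (ℕ → Tm) → Tm → Tm
subst σ (var n) = σ n
subst σ (lam A t) = lam A (subst (exts σ) t)
subst σ (app t u) = app (subst σ t) (subst σ u)

single : Tm → ℕ → Tm
single u zero = u
single u (suc n) = var n

_[_] : Tm → Tm → Tm
t [ u ] = subst (single u) t

infix 4 _≈βη_
data _≈βη_ : Tm → Tm → Set where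
  β      : ∀ {A t u} → app (lam A t) u ≈βη t [ u ]
  η      : ∀ {A t} → lam A (app (rename suc t) (var zero)) ≈βη t
  ≈refl  : ∀ {t} → t ≈βη t
  ≈sym   : ∀ {t u} → t ≈βη u → u ≈βη t
  ≈trans : ∀ {t u v} → t ≈βη u → u ≈βη v → t ≈βη v
  ξlam   : ∀ {A t t'} → t ≈βη t' → lam A t ≈βη lam A t'
  ξappˡ  : ∀ {t t' u} → t ≈βη t' → app t u ≈βη app t' u
  ξappʳ  : ∀ {t u u'} → u ≈βη u' → app t u ≈βη app t u'

-- Linear contexts: position i holds 'just A' if variable i (of type A)
-- is available (must be used exactly once), 'nothing' otherwise.
Ctx : Set
Ctx = List (Maybe Ty)

data Split : Ctx → Ctx → Ctx → Set where
  []    : Split [] [] []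
  left  : ∀ {A Γ Δ Ε} → Split Γ Δ Ε → Split (just A ∷ Γ) (just A ∷ Δ) (nothing ∷ Ε)
  right : ∀ {A Γ Δ Ε} → Split Γ Δ Ε → Split (just A ∷ Γ) (nothing ∷ Δ) (just A ∷ Ε)
  none  : ∀ {Γ Δ Ε} → Split Γ Δ Ε → Split (nothing ∷ Γ) (nothing ∷ Δ) (nothing ∷ Ε)

data Only : Ctx → ℕ → Ty → Set where
  here  : ∀ {A Γ} → All (_≡ nothing) Γ → Only (just A ∷ Γ) zero A
  there : ∀ {Γ n A} → Only Γ n A → Only (nothing ∷ Γ) (suc n) A

infix 3 _⊢_∶_
data _⊢_∶_ : Ctx → Tm → Ty → Set where
  ⊢var : ∀ {Γ n A} → Only Γ n A → Γ ⊢ var n ∶ A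
  ⊢lam : ∀ {Γ A B t} → just A ∷ Γ ⊢ t ∶ B → Γ ⊢ lam A t ∶ A ⊸ B
  ⊢app : ∀ {Γ Δ Ε A B t u} → Split Γ Δ Ε → Δ ⊢ t ∶ A ⊸ B → Ε ⊢ u ∶ A → Γ ⊢ app t u ∶ B

Closed : Tm → Ty → Set
Closed t A = [] ⊢ t ∶ A

-- One-hole context with hole of conclusion A and overall conclusion B:
-- a linear term whose only free variable (index 0) has type A.
OneHole : Tm → Ty → Ty → Set
OneHole C A B = just A ∷ [] ⊢ C ∶ B

plug : Tm → Tm → Tm
plug C Θ = C [ Θ ]

Bool : Ty
Bool = p ⊸ (p ⊸ p) ⊸ (p ⊸ p) ⊸ p

-- 0 = λx.λf.λg. g (f x),  1 = λx.λf.λg. f (g x)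
zero̲ : Tm
zero̲ = lam p (lam (p ⊸ p) (lam (p ⊸ p) (app (var 0) (app (var 1) (var 2)))))

one̲ : Tm
one̲ = lam p (lam (p ⊸ p) (lam (p ⊸ p) (app (var 1) (app (var 0) (var 2)))))

-- Normalise both nets to η-long β-normal forms and label the axiom links of their conclusion
-- by distinct numbers. The trace of a normal form, the order in which it traverses the axiom
-- links (head variable first, then the arguments from last to first), is a permutation of all
-- labels and determines the normal form, so two distinct normal forms traverse some pair of
-- labels i, j in opposite orders. Instantiating p by Bool, the context λ x f g. [ ] P₁ ⋯ Pₖ x id id
-- applies the net to probes Pᵢ under which the axiom link labelled l acts as an endomorphism κ l
-- of p, and the result is λ x f g. κ l₁ (⋯ (κ lₙ x)) along the trace l₁ ⋯ lₙ. With κ i = f,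
-- κ j = g and the identity elsewhere, this is g (f x) for one net and f (g x) for the other.

module Submission where

open import Defs
open import Level using (0ℓ)
open import Function using (_∘_)
open import Data.Empty using (⊥; ⊥-elim)
open import Data.Unit using (⊤; tt)
open import Data.Product using (Σ; _×_; _,_; proj₁; proj₂)
open import Data.Sum using (_⊎_; inj₁; inj₂; [_,_]′)
open import Data.Maybe using (Maybe; just; nothing)
open import Data.Nat using (ℕ; zero; suc; _+_; _<_; s≤s)
open import Data.Nat.Properties
  using (_≟_; +-commutativeSemigroup; +-assoc; +-identityʳ; +-suc; +-monoʳ-<; +-monoˡ-<; <⇒≢; m<n⇒m<1+n;
         ≤-refl; ≤-reflexive; ≤-trans; n≤1+n)
open import Algebra.Properties.CommutativeSemigroup +-commutativeSemigroup using (xy∙z≈xz∙y)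
open import Data.List using (List; []; _∷_; _++_; map)
open import Data.List.Properties using (map-∘; ++-assoc; ++-identityʳ; ∷-injective; ≡-dec)
open import Data.List.Relation.Unary.All using (All; []; _∷_)
import Data.List.Relation.Unary.All as All
import Data.List.Relation.Unary.All.Properties as All
open import Data.List.Relation.Unary.Any using (here; there)
open import Data.List.Relation.Unary.AllPairs using ([]; _∷_)
open import Data.List.Relation.Unary.Unique.Propositional using (Unique)
open import Data.List.Membership.Propositional using (_∈_; _∉_)
open import Data.List.Membership.Propositional.Properties using (∈-++⁺ˡ; ∈-++⁺ʳ; ∈-++⁻; ∈-∃++)
open import Data.List.Membership.DecPropositional _≟_ using (_∈?_)
open import Data.List.Relation.Binary.Permutation.Propositional
  using (_↭_; ↭-refl; ↭-prep; ↭-reflexive; ↭-sym; ↭-trans; ↭⇒↭ₛ; module PermutationReasoning)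
open import Data.List.Relation.Binary.Permutation.Propositional.Properties
  using (++-comm; ++⁺; ++⁺ˡ; ++⁺ʳ; shift; shifts; ∷↭∷ʳ; Any-resp-↭; drop-∷; ↭-length)
import Data.List.Relation.Binary.Permutation.Setoid.Properties as Setoidᴾ
open import Relation.Nullary using (¬_; yes; no)
open import Relation.Binary.Bundles using (Setoid)
open import Relation.Binary.PropositionalEquality
  using (_≡_; _≢_; _≗_; refl; sym; trans; cong; cong₂; module ≡-Reasoning) renaming (subst to ≡-subst)
open import Relation.Binary.PropositionalEquality.Properties using (setoid)
import Relation.Binary.Reasoning.Setoid as SetoidReasoning

-- Renaming and substitution

ext-cong : ∀ {ρ ρ′ : ℕ → ℕ} → (∀ n → ρ n ≡ ρ′ n) → ∀ n → ext ρ n ≡ ext ρ′ n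
ext-cong e zero = refl
ext-cong e (suc n) = cong suc (e n)

rename-cong : ∀ {ρ ρ′} → (∀ n → ρ n ≡ ρ′ n) → ∀ t → rename ρ t ≡ rename ρ′ t
rename-cong e (var n) = cong var (e n)
rename-cong e (lam A t) = cong (lam A) (rename-cong (ext-cong e) t)
rename-cong e (app t u) = cong₂ app (rename-cong e t) (rename-cong e u)

exts-cong : ∀ {σ σ′ : ℕ → Tm} → (∀ n → σ n ≡ σ′ n) → ∀ n → exts σ n ≡ exts σ′ n
exts-cong e zero = refl
exts-cong e (suc n) = cong (rename suc) (e n)

subst-cong : ∀ {σ σ′} → (∀ n → σ n ≡ σ′ n) → ∀ t → subst σ t ≡ subst σ′ t
subst-cong e (var n) = e n
subst-cong e (lam A t) = cong (lam A) (subst-cong (exts-cong e) t)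
subst-cong e (app t u) = cong₂ app (subst-cong e t) (subst-cong e u)

rename-rename : ∀ ρ ρ′ t → rename ρ′ (rename ρ t) ≡ rename (ρ′ ∘ ρ) t
rename-rename ρ ρ′ (var n) = refl
rename-rename ρ ρ′ (lam A t) =
  cong (lam A) (trans (rename-rename (ext ρ) (ext ρ′) t) (rename-cong ext-∘ t))
  where
  ext-∘ : ∀ n → ext ρ′ (ext ρ n) ≡ ext (ρ′ ∘ ρ) n
  ext-∘ zero = refl
  ext-∘ (suc n) = refl
rename-rename ρ ρ′ (app t u) = cong₂ app (rename-rename ρ ρ′ t) (rename-rename ρ ρ′ u)

subst-rename : ∀ ρ σ t → subst σ (rename ρ t) ≡ subst (σ ∘ ρ) t
subst-rename ρ σ (var n) = refl
subst-rename ρ σ (lam A t) =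
  cong (lam A) (trans (subst-rename (ext ρ) (exts σ) t) (subst-cong exts-∘ t))
  where
  exts-∘ : ∀ n → exts σ (ext ρ n) ≡ exts (σ ∘ ρ) n
  exts-∘ zero = refl
  exts-∘ (suc n) = refl
subst-rename ρ σ (app t u) = cong₂ app (subst-rename ρ σ t) (subst-rename ρ σ u)

rename-subst : ∀ σ ρ t → rename ρ (subst σ t) ≡ subst (rename ρ ∘ σ) t
rename-subst σ ρ (var n) = refl
rename-subst σ ρ (lam A t) =
  cong (lam A) (trans (rename-subst (exts σ) (ext ρ) t) (subst-cong ext-exts t))
  where
  ext-exts : ∀ n → rename (ext ρ) (exts σ n) ≡ exts (rename ρ ∘ σ) n
  ext-exts zero = refl
  ext-exts (suc n) = trans (rename-rename suc (ext ρ) (σ n)) (sym (rename-rename ρ suc (σ n)))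
rename-subst σ ρ (app t u) = cong₂ app (rename-subst σ ρ t) (rename-subst σ ρ u)

subst-subst : ∀ σ τ t → subst τ (subst σ t) ≡ subst (subst τ ∘ σ) t
subst-subst σ τ (var n) = refl
subst-subst σ τ (lam A t) =
  cong (lam A) (trans (subst-subst (exts σ) (exts τ) t) (subst-cong exts-exts t))
  where
  exts-exts : ∀ n → subst (exts τ) (exts σ n) ≡ exts (subst τ ∘ σ) n
  exts-exts zero = refl
  exts-exts (suc n) = trans (subst-rename suc (exts τ) (σ n)) (sym (rename-subst τ suc (σ n)))
subst-subst σ τ (app t u) = cong₂ app (subst-subst σ τ t) (subst-subst σ τ u)

subst-var : ∀ t → subst var t ≡ t
subst-var (var n) = refl
subst-var (lam A t) = cong (lam A) (trans (subst-cong exts-var t) (subst-var t))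
  where
  exts-var : ∀ n → exts var n ≡ var n
  exts-var zero = refl
  exts-var (suc n) = refl
subst-var (app t u) = cong₂ app (subst-var t) (subst-var u)

rename-as-subst : ∀ ρ t → rename ρ t ≡ subst (var ∘ ρ) t
rename-as-subst ρ t = trans (sym (subst-var (rename ρ t))) (subst-rename ρ var t)

rename-ext-suc : ∀ ρ t → rename (ext ρ) (rename suc t) ≡ rename suc (rename ρ t)
rename-ext-suc ρ t = trans (rename-rename suc (ext ρ) t) (sym (rename-rename ρ suc t))

subst-exts-suc : ∀ σ t → subst (exts σ) (rename suc t) ≡ rename suc (subst σ t)
subst-exts-suc σ t = trans (subst-rename suc (exts σ) t) (sym (rename-subst σ suc t))

rename-suc-[] : ∀ t u → rename suc t [ u ] ≡ t
rename-suc-[] t u = trans (subst-rename suc (single u) t) (subst-var t)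

infixr 5 _•_
_•_ : Tm → (ℕ → Tm) → ℕ → Tm
(u • σ) zero = u
(u • σ) (suc n) = σ n

exts-[] : ∀ σ t u → subst (exts σ) t [ u ] ≡ subst (u • σ) t
exts-[] σ t u = trans (subst-subst (exts σ) (single u) t) (subst-cong exts-single t)
  where
  exts-single : ∀ n → exts σ n [ u ] ≡ (u • σ) n
  exts-single zero = refl
  exts-single (suc n) = rename-suc-[] (σ n) u

rename-[] : ∀ ρ t u → rename ρ (t [ u ]) ≡ rename (ext ρ) t [ rename ρ u ]
rename-[] ρ t u = trans (rename-subst (single u) ρ t)
  (trans (subst-cong single-ext t) (sym (subst-rename (ext ρ) (single (rename ρ u)) t)))
  where
  single-ext : ∀ n → rename ρ (single u n) ≡ single (rename ρ u) (ext ρ n)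
  single-ext zero = refl
  single-ext (suc n) = refl

subst-[] : ∀ σ t u → subst σ (t [ u ]) ≡ subst (exts σ) t [ subst σ u ]
subst-[] σ t u = trans (subst-subst (single u) σ t)
  (trans (subst-cong single-exts t) (sym (subst-subst (exts σ) (single (subst σ u)) t)))
  where
  single-exts : ∀ n → subst σ (single u n) ≡ exts σ n [ subst σ u ]
  single-exts zero = refl
  single-exts (suc n) = sym (rename-suc-[] (σ n) (subst σ u))

tsub-rename : ∀ B ρ t → tsub B (rename ρ t) ≡ rename ρ (tsub B t)
tsub-rename B ρ (var n) = refl
tsub-rename B ρ (lam A t) = cong (lam (A [ B /p])) (tsub-rename B (ext ρ) t)
tsub-rename B ρ (app t u) = cong₂ app (tsub-rename B ρ t) (tsub-rename B ρ u)

tsub-subst : ∀ B σ t → tsub B (subst σ t) ≡ subst (tsub B ∘ σ) (tsub B t)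
tsub-subst B σ (var n) = refl
tsub-subst B σ (lam A t) =
  cong (lam (A [ B /p])) (trans (tsub-subst B (exts σ) t) (subst-cong tsub-exts (tsub B t)))
  where
  tsub-exts : ∀ n → tsub B (exts σ n) ≡ exts (tsub B ∘ σ) n
  tsub-exts zero = refl
  tsub-exts (suc n) = tsub-rename B suc (σ n)
tsub-subst B σ (app t u) = cong₂ app (tsub-subst B σ t) (tsub-subst B σ u)

tsub-[] : ∀ B t u → tsub B (t [ u ]) ≡ tsub B t [ tsub B u ]
tsub-[] B t u = trans (tsub-subst B (single u) t) (subst-cong tsub-single (tsub B t))
  where
  tsub-single : ∀ n → tsub B (single u n) ≡ single (tsub B u) n
  tsub-single zero = refl
  tsub-single (suc n) = refl

apps : Tm → List Tm → Tm
apps t [] = t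
apps t (u ∷ us) = apps (app t u) us

apps-∷ʳ : ∀ t us u → apps t (us ++ u ∷ []) ≡ app (apps t us) u
apps-∷ʳ t [] u = refl
apps-∷ʳ t (v ∷ us) u = apps-∷ʳ (app t v) us u

rename-apps : ∀ ρ t us → rename ρ (apps t us) ≡ apps (rename ρ t) (map (rename ρ) us)
rename-apps ρ t [] = refl
rename-apps ρ t (u ∷ us) = rename-apps ρ (app t u) us

subst-apps : ∀ σ t us → subst σ (apps t us) ≡ apps (subst σ t) (map (subst σ) us)
subst-apps σ t [] = refl
subst-apps σ t (u ∷ us) = subst-apps σ (app t u) us

tsub-apps : ∀ B t us → tsub B (apps t us) ≡ apps (tsub B t) (map (tsub B) us)
tsub-apps B t [] = refl
tsub-apps B t (u ∷ us) = tsub-apps B (app t u) us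

subst-tsub-apps : ∀ σ B t us → subst σ (tsub B (apps t us)) ≡ apps (subst σ (tsub B t)) (map (subst σ ∘ tsub B) us)
subst-tsub-apps σ B t us = begin
  subst σ (tsub B (apps t us))                          ≡⟨ cong (subst σ) (tsub-apps B t us) ⟩
  subst σ (apps (tsub B t) (map (tsub B) us))           ≡⟨ subst-apps σ (tsub B t) (map (tsub B) us) ⟩
  apps (subst σ (tsub B t)) (map (subst σ) (map (tsub B) us)) ≡⟨ cong (apps _) (sym (map-∘ us)) ⟩
  apps (subst σ (tsub B t)) (map (subst σ ∘ tsub B) us) ∎
  where open ≡-Reasoning

-- βη-conversion

≈βη-setoid : Setoid 0ℓ 0ℓ
≈βη-setoid = record
  { Carrier = Tm
  ; _≈_ = _≈βη_
  ; isEquivalence = record { refl = ≈refl ; sym = ≈sym ; trans = ≈trans }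
  }

module ≈βη-Reasoning = SetoidReasoning ≈βη-setoid

≡⇒≈βη : ∀ {t u} → t ≡ u → t ≈βη u
≡⇒≈βη refl = ≈refl

apps-congˡ : ∀ {t t′} us → t ≈βη t′ → apps t us ≈βη apps t′ us
apps-congˡ [] e = e
apps-congˡ (u ∷ us) e = apps-congˡ us (ξappˡ e)

rename-≈βη : ∀ ρ {t u} → t ≈βη u → rename ρ t ≈βη rename ρ u
rename-≈βη ρ (β {t = t} {u}) = ≈trans β (≡⇒≈βη (sym (rename-[] ρ t u)))
rename-≈βη ρ (η {A} {t}) = ≈trans (≡⇒≈βη (cong (λ z → lam A (app z (var zero))) (rename-ext-suc ρ t))) η
rename-≈βη ρ ≈refl = ≈refl
rename-≈βη ρ (≈sym e) = ≈sym (rename-≈βη ρ e)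
rename-≈βη ρ (≈trans e e′) = ≈trans (rename-≈βη ρ e) (rename-≈βη ρ e′)
rename-≈βη ρ (ξlam e) = ξlam (rename-≈βη (ext ρ) e)
rename-≈βη ρ (ξappˡ e) = ξappˡ (rename-≈βη ρ e)
rename-≈βη ρ (ξappʳ e) = ξappʳ (rename-≈βη ρ e)

subst-≈βη : ∀ σ {t u} → t ≈βη u → subst σ t ≈βη subst σ u
subst-≈βη σ (β {t = t} {u}) = ≈trans β (≡⇒≈βη (sym (subst-[] σ t u)))
subst-≈βη σ (η {A} {t}) = ≈trans (≡⇒≈βη (cong (λ z → lam A (app z (var zero))) (subst-exts-suc σ t))) η
subst-≈βη σ ≈refl = ≈refl
subst-≈βη σ (≈sym e) = ≈sym (subst-≈βη σ e)
subst-≈βη σ (≈trans e e′) = ≈trans (subst-≈βη σ e) (subst-≈βη σ e′)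
subst-≈βη σ (ξlam e) = ξlam (subst-≈βη (exts σ) e)
subst-≈βη σ (ξappˡ e) = ξappˡ (subst-≈βη σ e)
subst-≈βη σ (ξappʳ e) = ξappʳ (subst-≈βη σ e)

tsub-≈βη : ∀ B {t u} → t ≈βη u → tsub B t ≈βη tsub B u
tsub-≈βη B (β {t = t} {u}) = ≈trans β (≡⇒≈βη (sym (tsub-[] B t u)))
tsub-≈βη B (η {A} {t}) = ≈trans (≡⇒≈βη (cong (λ z → lam (A [ B /p]) (app z (var zero))) (tsub-rename B suc t))) η
tsub-≈βη B ≈refl = ≈refl
tsub-≈βη B (≈sym e) = ≈sym (tsub-≈βη B e)
tsub-≈βη B (≈trans e e′) = ≈trans (tsub-≈βη B e) (tsub-≈βη B e′)
tsub-≈βη B (ξlam e) = ξlam (tsub-≈βη B e)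
tsub-≈βη B (ξappˡ e) = ξappˡ (tsub-≈βη B e)
tsub-≈βη B (ξappʳ e) = ξappʳ (tsub-≈βη B e)

-- Linear contexts and typing

Empty : Ctx → Set
Empty = All (_≡ nothing)

split-comm : ∀ {Γ Δ Ε} → Split Γ Δ Ε → Split Γ Ε Δ
split-comm [] = []
split-comm (left s) = right (split-comm s)
split-comm (right s) = left (split-comm s)
split-comm (none s) = none (split-comm s)

split-exchange : ∀ {Γ Γ′ Δ Ε Φ} → Split Γ Γ′ Φ → Split Γ′ Δ Ε → Σ Ctx λ Ψ → Split Ψ Δ Φ × Split Γ Ψ Ε
split-exchange [] [] = [] , [] , []
split-exchange (left s) (left s′) with split-exchange s s′
... | _ , s₁ , s₂ = _ , left s₁ , left s₂
split-exchange (left s) (right s′) with split-exchange s s′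
... | _ , s₁ , s₂ = _ , none s₁ , right s₂
split-exchange (right s) (none s′) with split-exchange s s′
... | _ , s₁ , s₂ = _ , right s₁ , left s₂
split-exchange (none s) (none s′) with split-exchange s s′
... | _ , s₁ , s₂ = _ , none s₁ , none s₂

split-emptyʳ : ∀ {Γ Δ Ε} → Split Γ Δ Ε → Empty Ε → Γ ≡ Δ
split-emptyʳ [] [] = refl
split-emptyʳ (left s) (refl ∷ e) = cong (just _ ∷_) (split-emptyʳ s e)
split-emptyʳ (none s) (refl ∷ e) = cong (nothing ∷_) (split-emptyʳ s e)

split-emptyˡ : ∀ {Γ Δ Ε} → Split Γ Δ Ε → Empty Δ → Γ ≡ Ε
split-emptyˡ s = split-emptyʳ (split-comm s)

erase : Ctx → Ctx
erase [] = []
erase (_ ∷ Γ) = nothing ∷ erase Γ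

erase-empty : ∀ Γ → Empty (erase Γ)
erase-empty [] = []
erase-empty (_ ∷ Γ) = refl ∷ erase-empty Γ

split-erase : ∀ Γ → Split Γ Γ (erase Γ)
split-erase [] = []
split-erase (just _ ∷ Γ) = left (split-erase Γ)
split-erase (nothing ∷ Γ) = none (split-erase Γ)

weakenAt : ℕ → ℕ → ℕ
weakenAt zero = suc
weakenAt (suc m) = ext (weakenAt m)

data InsertAt : ℕ → Ctx → Ctx → Set where
  iz : ∀ {Γ} → InsertAt zero Γ (nothing ∷ Γ)
  is : ∀ {m a Γ Γ′} → InsertAt m Γ Γ′ → InsertAt (suc m) (a ∷ Γ) (a ∷ Γ′)

insertAt-empty : ∀ {m Γ Γ′} → InsertAt m Γ Γ′ → Empty Γ → Empty Γ′
insertAt-empty iz e = refl ∷ e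
insertAt-empty (is i) (x ∷ e) = x ∷ insertAt-empty i e

insertAt-only : ∀ {m Γ Γ′ n A} → InsertAt m Γ Γ′ → Only Γ n A → Only Γ′ (weakenAt m n) A
insertAt-only iz o = there o
insertAt-only (is i) (here e) = here (insertAt-empty i e)
insertAt-only (is i) (there o) = there (insertAt-only i o)

insertAt-split : ∀ {m Γ Γ′ Δ Ε} → InsertAt m Γ Γ′ → Split Γ Δ Ε →
  Σ Ctx λ Δ′ → Σ Ctx λ Ε′ → InsertAt m Δ Δ′ × InsertAt m Ε Ε′ × Split Γ′ Δ′ Ε′
insertAt-split iz s = _ , _ , iz , iz , none s
insertAt-split (is i) (left s) with insertAt-split i s
... | _ , _ , iΔ , iΕ , s′ = _ , _ , is iΔ , is iΕ , left s′
insertAt-split (is i) (right s) with insertAt-split i s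
... | _ , _ , iΔ , iΕ , s′ = _ , _ , is iΔ , is iΕ , right s′
insertAt-split (is i) (none s) with insertAt-split i s
... | _ , _ , iΔ , iΕ , s′ = _ , _ , is iΔ , is iΕ , none s′

rename-typed : ∀ {m Γ Γ′ t A} → InsertAt m Γ Γ′ → Γ ⊢ t ∶ A → Γ′ ⊢ rename (weakenAt m) t ∶ A
rename-typed i (⊢var o) = ⊢var (insertAt-only i o)
rename-typed i (⊢lam d) = ⊢lam (rename-typed (is i) d)
rename-typed i (⊢app s d e) with insertAt-split i s
... | _ , _ , iΔ , iΕ , s′ = ⊢app s′ (rename-typed iΔ d) (rename-typed iΕ e)

weaken-typed : ∀ {Γ t A} → Γ ⊢ t ∶ A → nothing ∷ Γ ⊢ rename suc t ∶ A
weaken-typed = rename-typed iz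

-- Variables have size 0, so that substituting u for a linear variable adds exactly size u.
size : Tm → ℕ
size (var n) = 0
size (lam A t) = suc (size t)
size (app t u) = suc (size t + size u)

size-rename : ∀ ρ t → size (rename ρ t) ≡ size t
size-rename ρ (var n) = refl
size-rename ρ (lam A t) = cong suc (size-rename (ext ρ) t)
size-rename ρ (app t u) = cong suc (cong₂ _+_ (size-rename ρ t) (size-rename ρ u))

substAt : ℕ → Tm → ℕ → Tm
substAt zero u = single u
substAt (suc n) u = exts (substAt n u)

substAt-weakenAt : ∀ n u m → substAt n u (weakenAt n m) ≡ var m
substAt-weakenAt zero u m = refl
substAt-weakenAt (suc n) u zero = refl
substAt-weakenAt (suc n) u (suc m) = cong (rename suc) (substAt-weakenAt n u m)

pad : ℕ → Ctx → Ctx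
pad zero Ε = Ε
pad (suc n) Ε = nothing ∷ pad n Ε

substAt-here : ∀ n {Ε u A} → Ε ⊢ u ∶ A → (pad n Ε ⊢ substAt n u n ∶ A) × (size (substAt n u n) ≡ size u)
substAt-here zero d = d , refl
substAt-here (suc n) {u = u} d with substAt-here n d
... | d′ , eq = weaken-typed d′ , trans (size-rename suc (substAt n u n)) eq

uninsert-only : ∀ {n Γ Γ′ m B} → InsertAt n Γ Γ′ → Only Γ′ m B → Σ ℕ λ m′ → (m ≡ weakenAt n m′) × Only Γ m′ B
uninsert-only iz (there o) = _ , refl , o
uninsert-only (is i) (here e) = zero , refl , here (uninsert-empty i e)
  where
  uninsert-empty : ∀ {n Γ Γ′} → InsertAt n Γ Γ′ → Empty Γ′ → Empty Γ
  uninsert-empty iz (_ ∷ e) = e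
  uninsert-empty (is i) (x ∷ e) = x ∷ uninsert-empty i e
uninsert-only (is i) (there o) with uninsert-only i o
... | m′ , refl , o′ = suc m′ , refl , there o′

uninsert-split : ∀ {n Γ Γ′ Δ′ Ε′} → InsertAt n Γ Γ′ → Split Γ′ Δ′ Ε′ →
  Σ Ctx λ Δ → Σ Ctx λ Ε → InsertAt n Δ Δ′ × InsertAt n Ε Ε′ × Split Γ Δ Ε
uninsert-split iz (none s) = _ , _ , iz , iz , s
uninsert-split (is i) (left s) with uninsert-split i s
... | _ , _ , iΔ , iΕ , s′ = _ , _ , is iΔ , is iΕ , left s′
uninsert-split (is i) (right s) with uninsert-split i s
... | _ , _ , iΔ , iΕ , s′ = _ , _ , is iΔ , is iΕ , right s′
uninsert-split (is i) (none s) with uninsert-split i s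
... | _ , _ , iΔ , iΕ , s′ = _ , _ , is iΔ , is iΕ , none s′

substAt-unused : ∀ {n Γ Γ′ t B} u → InsertAt n Γ Γ′ → Γ′ ⊢ t ∶ B →
  (Γ ⊢ subst (substAt n u) t ∶ B) × (size (subst (substAt n u) t) ≡ size t)
substAt-unused {n} u i (⊢var o) with uninsert-only i o
... | m′ , refl , o′ rewrite substAt-weakenAt n u m′ = ⊢var o′ , refl
substAt-unused u i (⊢lam d) with substAt-unused u (is i) d
... | d′ , eq = ⊢lam d′ , cong suc eq
substAt-unused u i (⊢app s d e) with uninsert-split i s
... | _ , _ , iΔ , iΕ , s′ with substAt-unused u iΔ d | substAt-unused u iΕ e
... | d′ , eq₁ | e′ , eq₂ = ⊢app s′ d′ e′ , cong suc (cong₂ _+_ eq₁ eq₂)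

data Hole : ℕ → Ty → Ctx → Ctx → Set where
  hz : ∀ {A Γ} → Hole zero A (just A ∷ Γ) Γ
  hs : ∀ {n A a Γ Γ′} → Hole n A Γ Γ′ → Hole (suc n) A (a ∷ Γ) (a ∷ Γ′)

hole-split : ∀ {n A Γ Γ′ Δ Ε} → Hole n A Γ Γ′ → Split Γ Δ Ε →
  (Σ Ctx λ Δ′ → Σ Ctx λ Ε′ → Hole n A Δ Δ′ × InsertAt n Ε′ Ε × Split Γ′ Δ′ Ε′) ⊎
  (Σ Ctx λ Δ′ → Σ Ctx λ Ε′ → InsertAt n Δ′ Δ × Hole n A Ε Ε′ × Split Γ′ Δ′ Ε′)
hole-split hz (left s) = inj₁ (_ , _ , hz , iz , s)
hole-split hz (right s) = inj₂ (_ , _ , iz , hz , s)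
hole-split (hs h) (left s) with hole-split h s
... | inj₁ (_ , _ , hΔ , iΕ , s′) = inj₁ (_ , _ , hs hΔ , is iΕ , left s′)
... | inj₂ (_ , _ , iΔ , hΕ , s′) = inj₂ (_ , _ , is iΔ , hs hΕ , left s′)
hole-split (hs h) (right s) with hole-split h s
... | inj₁ (_ , _ , hΔ , iΕ , s′) = inj₁ (_ , _ , hs hΔ , is iΕ , right s′)
... | inj₂ (_ , _ , iΔ , hΕ , s′) = inj₂ (_ , _ , is iΔ , hs hΕ , right s′)
hole-split (hs h) (none s) with hole-split h s
... | inj₁ (_ , _ , hΔ , iΕ , s′) = inj₁ (_ , _ , hs hΔ , is iΕ , none s′)
... | inj₂ (_ , _ , iΔ , hΕ , s′) = inj₂ (_ , _ , is iΔ , hs hΕ , none s′)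

hole-only : ∀ {n A Γ Γ′ m B} → Hole n A Γ Γ′ → Only Γ m B → (m ≡ n) × (B ≡ A) × Empty Γ′
hole-only hz (here e) = refl , refl , e
hole-only (hs h) (here e) = ⊥-elim (hole-nonempty h e)
  where
  hole-nonempty : ∀ {n A Γ Γ′} → Hole n A Γ Γ′ → ¬ Empty Γ
  hole-nonempty hz (() ∷ _)
  hole-nonempty (hs h) (_ ∷ e) = hole-nonempty h e
hole-only (hs h) (there o) with hole-only h o
... | refl , refl , e = refl , refl , refl ∷ e

substAt-typed : ∀ {n A Γ Γ′ Ε Ψ t B u} → Hole n A Γ Γ′ → Γ ⊢ t ∶ B → Ε ⊢ u ∶ A → Split Ψ Γ′ (pad n Ε) →
  (Ψ ⊢ subst (substAt n u) t ∶ B) × (size (subst (substAt n u) t) ≡ size t + size u)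
substAt-typed {n} h (⊢var o) du s with hole-only h o
... | refl , refl , e rewrite split-emptyˡ s e = substAt-here n du
substAt-typed h (⊢lam d) du s with substAt-typed (hs h) d du (left s)
... | d′ , eq = ⊢lam d′ , cong suc eq
substAt-typed {u = u} h (⊢app {t = t₁} {u = t₂} s′ d e) du s with hole-split h s′
... | inj₁ (_ , _ , hΔ , iΕ , s″) with split-exchange s s″
...   | _ , s₁ , s₂ with substAt-typed hΔ d du s₁ | substAt-unused u iΕ e
...     | d′ , eq₁ | e′ , eq₂ =
  ⊢app s₂ d′ e′ , cong suc (trans (cong₂ _+_ eq₁ eq₂) (xy∙z≈xz∙y (size t₁) (size u) (size t₂)))
substAt-typed {u = u} h (⊢app {t = t₁} {u = t₂} s′ d e) du s | inj₂ (_ , _ , iΔ , hΕ , s″)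
  with split-exchange s (split-comm s″)
...   | _ , s₁ , s₂ with substAt-unused u iΔ d | substAt-typed hΕ e du s₁
...     | d′ , eq₁ | e′ , eq₂ =
  ⊢app (split-comm s₂) d′ e′ , cong suc (trans (cong₂ _+_ eq₁ eq₂) (sym (+-assoc (size t₁) (size t₂) (size u))))

[]-typed : ∀ {Γ Δ Ε A B t u} → Split Γ Δ Ε → just A ∷ Δ ⊢ t ∶ B → Ε ⊢ u ∶ A →
  (Γ ⊢ t [ u ] ∶ B) × (size (t [ u ]) ≡ size t + size u)
[]-typed s d e = substAt-typed hz d e s

-- η-long β-normal forms

mutual
  data Nf : Ctx → Tm → Ty → Set where
    nlam : ∀ {Γ A B t} → Nf (just A ∷ Γ) t B → Nf Γ (lam A t) (A ⊸ B)
    nne  : ∀ {Γ Δ Ε h A us} → Split Γ Δ Ε → Only Δ h A → Spine Ε A p us → Nf Γ (apps (var h) us) p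

  data Spine : Ctx → Ty → Ty → List Tm → Set where
    snil  : ∀ {Γ A} → Empty Γ → Spine Γ A A []
    scons : ∀ {Γ Δ Ε A B C u us} → Split Γ Δ Ε → Nf Δ u A → Spine Ε B C us → Spine Γ (A ⊸ B) C (u ∷ us)

NormalForm : Ctx → Tm → Ty → Set
NormalForm Γ t A = Σ Tm λ t′ → Nf Γ t′ A × (t ≈βη t′)

mutual
  nf-rename : ∀ {m Γ Γ′ t A} → InsertAt m Γ Γ′ → Nf Γ t A → Nf Γ′ (rename (weakenAt m) t) A
  nf-rename i (nlam n) = nlam (nf-rename (is i) n)
  nf-rename {m} i (nne {h = h} {us = us} s o sp) with insertAt-split i s
  ... | _ , _ , iΔ , iΕ , s′ rewrite rename-apps (weakenAt m) (var h) us =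
    nne s′ (insertAt-only iΔ o) (spine-rename iΕ sp)

  spine-rename : ∀ {m Γ Γ′ A C us} → InsertAt m Γ Γ′ → Spine Γ A C us → Spine Γ′ A C (map (rename (weakenAt m)) us)
  spine-rename i (snil e) = snil (insertAt-empty i e)
  spine-rename i (scons s n sp) with insertAt-split i s
  ... | _ , _ , iΔ , iΕ , s′ = scons s′ (nf-rename iΔ n) (spine-rename iΕ sp)

spine-∷ʳ : ∀ {Γ Δ Ε A B C us u} → Spine Δ A (B ⊸ C) us → Nf Ε u B → Split Γ Δ Ε → Spine Γ A C (us ++ u ∷ [])
spine-∷ʳ (snil e) n s = scons (split-comm s) n (snil e)
spine-∷ʳ (scons s₁ n₁ sp) n s with split-exchange s (split-comm s₁)
... | _ , s₂ , s₃ = scons (split-comm s₃) n₁ (spine-∷ʳ sp n s₂)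

η-expand : ∀ A {Γ Δ Ε h B us} → Split Γ Δ Ε → Only Δ h B → Spine Ε B A us → NormalForm Γ (apps (var h) us) A
η-expand p s o sp = _ , nne s o sp , ≈refl
η-expand (C ⊸ A) {Γ} {Ε = Ε} {h} {us = us} s o sp
  with η-expand C (split-erase (just C ∷ erase Ε)) (here (erase-empty Ε)) (snil (erase-empty (just C ∷ erase Ε)))
... | v , nv , ev with η-expand A (right s) (insertAt-only iz o) (spine-∷ʳ (spine-rename iz sp) nv (right (split-erase Ε)))
... | t , nt , et = lam C t , nlam nt , ≈trans (≈sym η) (ξlam expanded)
  where
  open ≈βη-Reasoning
  expanded : app (rename suc (apps (var h) us)) (var zero) ≈βη t
  expanded = begin
    app (rename suc (apps (var h) us)) (var zero)       ≡⟨ cong (λ z → app z (var zero)) (rename-apps suc (var h) us) ⟩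
    app (apps (var (suc h)) (map (rename suc) us)) (var zero) ≈⟨ ξappʳ ev ⟩
    app (apps (var (suc h)) (map (rename suc) us)) v    ≡⟨ sym (apps-∷ʳ (var (suc h)) (map (rename suc) us) v) ⟩
    apps (var (suc h)) (map (rename suc) us ++ v ∷ [])  ≈⟨ et ⟩
    t                                                    ∎

record SpineForm (Γ : Ctx) (t : Tm) (A : Ty) : Set where
  constructor spineForm
  field
    {h} : ℕ
    {B} : Ty
    {us} : List Tm
    {Δ Ε} : Ctx
    split : Split Γ Δ Ε
    head : Only Δ h B
    spine : Spine Ε B A us
    conv : t ≈βη apps (var h) us

mutual
  data Normal : Tm → Set where
    lam    : ∀ {A t} → Normal t → Normal (lam A t)
    neutral : ∀ {t} → Neutral t → Normal t

  data Neutral : Tm → Set where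
    var : ∀ {n} → Neutral (var n)
    app : ∀ {t u} → Neutral t → Normal u → Neutral (app t u)

mutual
  normal⇒nf : ∀ {Γ t A} → Γ ⊢ t ∶ A → Normal t → NormalForm Γ t A
  normal⇒nf (⊢lam d) (lam b) with normal⇒nf d b
  ... | t′ , n , e = lam _ t′ , nlam n , ξlam e
  normal⇒nf {A = A} d (neutral b) with neutral⇒spine d b
  ... | spineForm s o sp e with η-expand A s o sp
  ...   | t′ , n , e′ = t′ , n , ≈trans e e′

  neutral⇒spine : ∀ {Γ t A} → Γ ⊢ t ∶ A → Neutral t → SpineForm Γ t A
  neutral⇒spine {Γ} (⊢var o) var = spineForm (split-erase Γ) o (snil (erase-empty Γ)) ≈refl
  neutral⇒spine (⊢app s d e) (app b c) with neutral⇒spine d b | normal⇒nf e c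
  ... | spineForm {h} {us = us} s₁ o sp e₁ | u′ , nu , e₂ with split-exchange s (split-comm s₁)
  ...   | _ , s₂ , s₃ = spineForm (split-comm s₃) o (spine-∷ʳ sp nu s₂)
          (≈trans (ξappˡ e₁) (≈trans (ξappʳ e₂) (≡⇒≈βη (sym (apps-∷ʳ (var h) us u′)))))

data Progress (Γ : Ctx) (t : Tm) (A : Ty) : Set where
  done : Normal t → Progress Γ t A
  step : ∀ {t′} → Γ ⊢ t′ ∶ A → t ≈βη t′ → size t′ < size t → Progress Γ t A

progress : ∀ {Γ t A} → Γ ⊢ t ∶ A → Progress Γ t A
progress (⊢var o) = done (neutral var)
progress (⊢lam d) with progress d
... | done b = done (lam b)
... | step d′ e lt = step (⊢lam d′) (ξlam e) (s≤s lt)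
progress (⊢app s (⊢lam d) e) with []-typed s d e
... | d′ , eq = step d′ β (s≤s (≤-trans (≤-reflexive eq) (n≤1+n _)))
progress (⊢app s (⊢var o) e) with progress e
... | done c = done (neutral (app var c))
... | step e′ eq lt = step (⊢app s (⊢var o) e′) (ξappʳ eq) (s≤s (+-monoʳ-< 0 lt))
progress (⊢app {u = u} s d@(⊢app _ _ _) e) with progress d
... | step d′ eq lt = step (⊢app s d′ e) (ξappˡ eq) (s≤s (+-monoˡ-< (size u) lt))
... | done (neutral b) with progress e
...   | done c = done (neutral (app b c))
...   | step e′ eq lt = step (⊢app s d e′) (ξappʳ eq) (s≤s (+-monoʳ-< _ lt))

normalise-below : ∀ k {Γ t A} → Γ ⊢ t ∶ A → size t < k → NormalForm Γ t A
normalise-below (suc k) d (s≤s lt) with progress d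
... | done b = normal⇒nf d b
... | step d′ e lt′ with normalise-below k d′ (≤-trans lt′ lt)
...   | t′ , n , e′ = t′ , n , ≈trans e e′

normalise : ∀ {Γ t A} → Γ ⊢ t ∶ A → NormalForm Γ t A
normalise {t = t} d = normalise-below (suc (size t)) d ≤-refl

-- Labelled traces of normal forms

Unique-resp-↭ : ∀ {X : Set} {xs ys : List X} → xs ↭ ys → Unique xs → Unique ys
Unique-resp-↭ q = Setoidᴾ.Unique-resp-↭ (setoid _) (↭⇒↭ₛ q)

Unique-++⁻ˡ : ∀ {X : Set} (xs : List X) {ys} → Unique (xs ++ ys) → Unique xs
Unique-++⁻ˡ [] u = []
Unique-++⁻ˡ (x ∷ xs) (x∉ ∷ u) = All.++⁻ˡ xs x∉ ∷ Unique-++⁻ˡ xs u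

Unique-++⁻ʳ : ∀ {X : Set} (xs : List X) {ys} → Unique (xs ++ ys) → Unique ys
Unique-++⁻ʳ [] u = u
Unique-++⁻ʳ (x ∷ xs) (_ ∷ u) = Unique-++⁻ʳ xs u

Unique-++⇒disjoint : ∀ {X : Set} (xs : List X) {ys x} → Unique (xs ++ ys) → x ∈ xs → x ∈ ys → ⊥
Unique-++⇒disjoint (x ∷ xs) (x∉ ∷ u) (here refl) x∈ys = All.lookup (All.++⁻ʳ xs x∉) x∈ys refl
Unique-++⇒disjoint (x ∷ xs) (_ ∷ u) (there x∈xs) x∈ys = Unique-++⇒disjoint xs u x∈xs x∈ys

Unique-drop-middle : ∀ {X : Set} (xs ys : List X) {zs} → Unique (xs ++ ys ++ zs) → Unique (xs ++ zs)
Unique-drop-middle xs ys u = Unique-++⁻ʳ ys (Unique-resp-↭ (shifts xs ys) u)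

Unique-drop-last : ∀ {X : Set} (xs ys : List X) {zs} → Unique (xs ++ ys ++ zs) → Unique (xs ++ ys)
Unique-drop-last xs ys {zs} u = Unique-++⁻ˡ (xs ++ ys) (≡-subst Unique (sym (++-assoc xs ys zs)) u)

-- Lab⁻ A and Lab⁺ A label the negative occurrences of p in A⁻ and in A⁺.
-- Every axiom link has exactly one negative atom, so labels name axiom links.
mutual
  Lab⁻ : Ty → Set
  Lab⁻ p = ℕ
  Lab⁻ (A ⊸ B) = Lab⁺ A × Lab⁻ B

  Lab⁺ : Ty → Set
  Lab⁺ p = ⊤
  Lab⁺ (A ⊸ B) = Lab⁻ A × Lab⁺ B

mutual
  labs⁻ : ∀ A → Lab⁻ A → List ℕ
  labs⁻ p l = l ∷ []
  labs⁻ (A ⊸ B) (ℓA , ℓB) = labs⁺ A ℓA ++ labs⁻ B ℓB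

  labs⁺ : ∀ A → Lab⁺ A → List ℕ
  labs⁺ p _ = []
  labs⁺ (A ⊸ B) (ℓA , ℓB) = labs⁻ A ℓA ++ labs⁺ B ℓB

head⁻ : ∀ A → Lab⁻ A → ℕ
head⁻ p l = l
head⁻ (A ⊸ B) (_ , ℓB) = head⁻ B ℓB

head⁻∈labs⁻ : ∀ A ℓ → head⁻ A ℓ ∈ labs⁻ A ℓ
head⁻∈labs⁻ p l = here refl
head⁻∈labs⁻ (A ⊸ B) (ℓA , ℓB) = ∈-++⁺ʳ (labs⁺ A ℓA) (head⁻∈labs⁻ B ℓB)

mutual
  default⁻ : ∀ A → Lab⁻ A
  default⁻ p = zero
  default⁻ (A ⊸ B) = default⁺ A , default⁻ B

  default⁺ : ∀ A → Lab⁺ A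
  default⁺ p = tt
  default⁺ (A ⊸ B) = default⁻ A , default⁺ B

-- extend reads cast⁻ C B only at B = C; at distinct types it returns junk.
mutual
  cast⁻ : ∀ A B → Lab⁻ A → Lab⁻ B
  cast⁻ p p l = l
  cast⁻ (A ⊸ B) (A′ ⊸ B′) (ℓA , ℓB) = cast⁺ A A′ ℓA , cast⁻ B B′ ℓB
  cast⁻ p (_ ⊸ _) _ = default⁻ _
  cast⁻ (_ ⊸ _) p _ = default⁻ p

  cast⁺ : ∀ A B → Lab⁺ A → Lab⁺ B
  cast⁺ p p l = l
  cast⁺ (A ⊸ B) (A′ ⊸ B′) (ℓA , ℓB) = cast⁻ A A′ ℓA , cast⁺ B B′ ℓB
  cast⁺ p (_ ⊸ _) _ = default⁺ _
  cast⁺ (_ ⊸ _) p _ = default⁺ p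

mutual
  cast⁻-id : ∀ A ℓ → cast⁻ A A ℓ ≡ ℓ
  cast⁻-id p l = refl
  cast⁻-id (A ⊸ B) (ℓA , ℓB) = cong₂ _,_ (cast⁺-id A ℓA) (cast⁻-id B ℓB)

  cast⁺-id : ∀ A ℓ → cast⁺ A A ℓ ≡ ℓ
  cast⁺-id p l = refl
  cast⁺-id (A ⊸ B) (ℓA , ℓB) = cong₂ _,_ (cast⁻-id A ℓA) (cast⁺-id B ℓB)

Env : Set
Env = ℕ → (B : Ty) → Lab⁻ B

extend : ∀ C → Lab⁻ C → Env → Env
extend C ℓ env zero B = cast⁻ C B ℓ
extend C ℓ env (suc n) = env n

tail : Env → Env
tail env n = env (suc n)

labsCtx : Ctx → Env → List ℕ
labsCtx [] env = []
labsCtx (nothing ∷ Γ) env = labsCtx Γ (tail env)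
labsCtx (just A ∷ Γ) env = labs⁻ A (env zero A) ++ labsCtx Γ (tail env)

mutual
  trace : ∀ {Γ t A} → Nf Γ t A → Env → Lab⁺ A → List ℕ
  trace (nlam {A = C} n) env (ℓC , ℓB) = trace n (extend C ℓC env) ℓB
  trace (nne {h = h} {A = B} s o sp) env _ = head⁻ B (env h B) ∷ traceSpine sp env (env h B)

  traceSpine : ∀ {Γ A C us} → Spine Γ A C us → Env → Lab⁻ A → List ℕ
  traceSpine (snil _) env ℓ = []
  traceSpine (scons s n sp) env (ℓA , ℓB) = traceSpine sp env ℓB ++ trace n env ℓA

spine-result : ∀ {Γ A C us} → Spine Γ A C us → Lab⁻ A → Lab⁻ C
spine-result (snil _) ℓ = ℓ
spine-result (scons s n sp) (_ , ℓB) = spine-result sp ℓB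

head⁻-spine-result : ∀ {Γ A C us} (sp : Spine Γ A C us) ℓ → head⁻ A ℓ ≡ head⁻ C (spine-result sp ℓ)
head⁻-spine-result (snil _) ℓ = refl
head⁻-spine-result (scons s n sp) (_ , ℓB) = head⁻-spine-result sp ℓB

labsCtx-empty : ∀ {Γ} env → Empty Γ → labsCtx Γ env ≡ []
labsCtx-empty env [] = refl
labsCtx-empty env (refl ∷ e) = labsCtx-empty _ e

labsCtx-only : ∀ {Γ n B} env → Only Γ n B → labsCtx Γ env ≡ labs⁻ B (env n B)
labsCtx-only {B = B} env (here e) = trans (cong (labs⁻ B (env zero B) ++_) (labsCtx-empty _ e)) (++-identityʳ _)
labsCtx-only env (there o) = labsCtx-only _ o

labsCtx-split : ∀ {Γ Δ Ε} env → Split Γ Δ Ε → labsCtx Γ env ↭ labsCtx Δ env ++ labsCtx Ε env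
labsCtx-split env [] = ↭-refl
labsCtx-split {just A ∷ _} env (left s) =
  ↭-trans (++⁺ˡ (labs⁻ A (env zero A)) (labsCtx-split _ s)) (↭-sym (↭-reflexive (++-assoc (labs⁻ A (env zero A)) _ _)))
labsCtx-split {just A ∷ _} {_ ∷ Δ} env (right s) =
  ↭-trans (++⁺ˡ (labs⁻ A (env zero A)) (labsCtx-split _ s)) (shifts (labs⁻ A (env zero A)) (labsCtx Δ _))
labsCtx-split env (none s) = labsCtx-split _ s

labsCtx-extend : ∀ Γ C ℓ env L → labsCtx (just C ∷ Γ) (extend C ℓ env) ++ L ↭ labsCtx Γ env ++ labs⁻ C ℓ ++ L
labsCtx-extend Γ C ℓ env L = begin
  labsCtx (just C ∷ Γ) (extend C ℓ env) ++ L  ≡⟨ cong (λ ℓ′ → (labs⁻ C ℓ′ ++ labsCtx Γ env) ++ L) (cast⁻-id C ℓ) ⟩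
  (labs⁻ C ℓ ++ labsCtx Γ env) ++ L           ≡⟨ ++-assoc (labs⁻ C ℓ) _ _ ⟩
  labs⁻ C ℓ ++ labsCtx Γ env ++ L             ↭⟨ shifts (labs⁻ C ℓ) (labsCtx Γ env) ⟩
  labsCtx Γ env ++ labs⁻ C ℓ ++ L             ∎
  where open PermutationReasoning

mutual
  trace-↭ : ∀ {Γ t A} (N : Nf Γ t A) env ℓ → trace N env ℓ ↭ labsCtx Γ env ++ labs⁺ A ℓ
  trace-↭ {Γ} (nlam {A = C} {B = B} n) env (ℓC , ℓB) =
    ↭-trans (trace-↭ n (extend C ℓC env) ℓB) (labsCtx-extend Γ C ℓC env (labs⁺ B ℓB))
  trace-↭ {Γ} (nne {Δ = Δ} {Ε} {h} {B} s o sp) env _ = begin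
    head⁻ B ℓ ∷ traceSpine sp env ℓ                          ↭⟨ ∷↭∷ʳ (head⁻ B ℓ) (traceSpine sp env ℓ) ⟩
    traceSpine sp env ℓ ++ head⁻ B ℓ ∷ []                     ≡⟨ cong (λ x → traceSpine sp env ℓ ++ x ∷ []) (head⁻-spine-result sp ℓ) ⟩
    traceSpine sp env ℓ ++ labs⁻ p (spine-result sp ℓ)        ↭⟨ traceSpine-↭ sp env ℓ ⟩
    labsCtx Ε env ++ labs⁻ B ℓ                                ≡⟨ cong (labsCtx Ε env ++_) (sym (labsCtx-only env o)) ⟩
    labsCtx Ε env ++ labsCtx Δ env                            ↭⟨ ++-comm (labsCtx Ε env) (labsCtx Δ env) ⟩
    labsCtx Δ env ++ labsCtx Ε env                            ↭⟨ ↭-sym (labsCtx-split env s) ⟩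
    labsCtx Γ env                                             ≡⟨ sym (++-identityʳ _) ⟩
    labsCtx Γ env ++ []                                       ∎
    where
    open PermutationReasoning
    ℓ : Lab⁻ B
    ℓ = env h B

  traceSpine-↭ : ∀ {Γ A C us} (sp : Spine Γ A C us) env ℓ →
    traceSpine sp env ℓ ++ labs⁻ C (spine-result sp ℓ) ↭ labsCtx Γ env ++ labs⁻ A ℓ
  traceSpine-↭ (snil e) env ℓ = ↭-reflexive (cong (_++ _) (sym (labsCtx-empty env e)))
  traceSpine-↭ {Γ} {C = C} (scons {Δ = Δ} {Ε} {A} {B} s n sp) env (ℓA , ℓB) = begin
    (traceSpine sp env ℓB ++ trace n env ℓA) ++ rest            ≡⟨ ++-assoc (traceSpine sp env ℓB) _ _ ⟩
    traceSpine sp env ℓB ++ trace n env ℓA ++ rest              ↭⟨ shifts (traceSpine sp env ℓB) (trace n env ℓA) ⟩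
    trace n env ℓA ++ traceSpine sp env ℓB ++ rest              ↭⟨ ++⁺ (trace-↭ n env ℓA) (traceSpine-↭ sp env ℓB) ⟩
    (labsCtx Δ env ++ labs⁺ A ℓA) ++ labsCtx Ε env ++ labs⁻ B ℓB ↭⟨ ++-interchange (labsCtx Δ env) (labs⁺ A ℓA) _ _ ⟩
    (labsCtx Δ env ++ labsCtx Ε env) ++ labs⁺ A ℓA ++ labs⁻ B ℓB ↭⟨ ++⁺ʳ _ (↭-sym (labsCtx-split env s)) ⟩
    labsCtx Γ env ++ labs⁺ A ℓA ++ labs⁻ B ℓB                   ∎
    where
    open PermutationReasoning
    rest : List ℕ
    rest = labs⁻ C (spine-result sp ℓB)
    ++-interchange : ∀ (a b c d : List ℕ) → (a ++ b) ++ (c ++ d) ↭ (a ++ c) ++ (b ++ d)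
    ++-interchange a b c d = ↭-trans (↭-reflexive (++-assoc a b (c ++ d)))
      (↭-trans (++⁺ˡ a (shifts b c)) (↭-sym (↭-reflexive (++-assoc a c (b ++ d)))))

data Sub : Ctx → Ctx → Set where
  []   : Sub [] []
  keep : ∀ {A Δ Γ} → Sub Δ Γ → Sub (just A ∷ Δ) (just A ∷ Γ)
  drop : ∀ {A Δ Γ} → Sub Δ Γ → Sub (nothing ∷ Δ) (just A ∷ Γ)
  skip : ∀ {Δ Γ} → Sub Δ Γ → Sub (nothing ∷ Δ) (nothing ∷ Γ)

sub-trans : ∀ {Δ Γ Ψ} → Sub Δ Γ → Sub Γ Ψ → Sub Δ Ψ
sub-trans [] [] = []
sub-trans (keep a) (keep b) = keep (sub-trans a b)
sub-trans (drop a) (keep b) = drop (sub-trans a b)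
sub-trans (skip a) (drop b) = drop (sub-trans a b)
sub-trans (skip a) (skip b) = skip (sub-trans a b)

split-subˡ : ∀ {Γ Δ Ε} → Split Γ Δ Ε → Sub Δ Γ
split-subˡ [] = []
split-subˡ (left s) = keep (split-subˡ s)
split-subˡ (right s) = drop (split-subˡ s)
split-subˡ (none s) = skip (split-subˡ s)

split-subʳ : ∀ {Γ Δ Ε} → Split Γ Δ Ε → Sub Ε Γ
split-subʳ s = split-subˡ (split-comm s)

infix 4 _∋_∶_
data _∋_∶_ : Ctx → ℕ → Ty → Set where
  az : ∀ {A Γ} → just A ∷ Γ ∋ zero ∶ A
  as : ∀ {a Γ n A} → Γ ∋ n ∶ A → a ∷ Γ ∋ suc n ∶ A

∋-sub : ∀ {Δ Γ n A} → Δ ∋ n ∶ A → Sub Δ Γ → Γ ∋ n ∶ A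
∋-sub az (keep s) = az
∋-sub (as x) (keep s) = as (∋-sub x s)
∋-sub (as x) (drop s) = as (∋-sub x s)
∋-sub (as x) (skip s) = as (∋-sub x s)

only-sub⇒∋ : ∀ {Δ Γ n A} → Only Δ n A → Sub Δ Γ → Γ ∋ n ∶ A
only-sub⇒∋ (here _) (keep s) = az
only-sub⇒∋ (there o) (drop s) = as (only-sub⇒∋ o s)
only-sub⇒∋ (there o) (skip s) = as (only-sub⇒∋ o s)

∋-functional : ∀ {Γ h B₁ B₂} → Γ ∋ h ∶ B₁ → Γ ∋ h ∶ B₂ → B₁ ≡ B₂
∋-functional az az = refl
∋-functional (as x) (as y) = ∋-functional x y

∋⇒labs⁻⊆labsCtx : ∀ {Γ h B l} env → Γ ∋ h ∶ B → l ∈ labs⁻ B (env h B) → l ∈ labsCtx Γ env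
∋⇒labs⁻⊆labsCtx env az l∈ = ∈-++⁺ˡ l∈
∋⇒labs⁻⊆labsCtx {just A ∷ _} env (as x) l∈ = ∈-++⁺ʳ (labs⁻ A (env zero A)) (∋⇒labs⁻⊆labsCtx _ x l∈)
∋⇒labs⁻⊆labsCtx {nothing ∷ _} env (as x) l∈ = ∋⇒labs⁻⊆labsCtx _ x l∈

head⁻-injective : ∀ {Γ h₁ h₂ B₁ B₂} env → Γ ∋ h₁ ∶ B₁ → Γ ∋ h₂ ∶ B₂ → Unique (labsCtx Γ env) →
  head⁻ B₁ (env h₁ B₁) ≡ head⁻ B₂ (env h₂ B₂) → h₁ ≡ h₂
head⁻-injective env az az u eq = refl
head⁻-injective {just A ∷ _} {B₂ = B₂} env az (as {n = n} y) u eq =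
  ⊥-elim (Unique-++⇒disjoint (labs⁻ A (env zero A)) u (head⁻∈labs⁻ A _)
    (∋⇒labs⁻⊆labsCtx _ y (≡-subst (_∈ labs⁻ B₂ (env (suc n) B₂)) (sym eq) (head⁻∈labs⁻ B₂ _))))
head⁻-injective {just A ∷ _} {B₁ = B₁} env (as {n = n} x) az u eq =
  ⊥-elim (Unique-++⇒disjoint (labs⁻ A (env zero A)) u (head⁻∈labs⁻ A _)
    (∋⇒labs⁻⊆labsCtx _ x (≡-subst (_∈ labs⁻ B₁ (env (suc n) B₁)) eq (head⁻∈labs⁻ B₁ _))))
head⁻-injective {just A ∷ _} env (as x) (as y) u eq =
  cong suc (head⁻-injective (tail env) x y (Unique-++⁻ʳ (labs⁻ A (env zero A)) u) eq)
head⁻-injective {nothing ∷ _} env (as x) (as y) u eq = cong suc (head⁻-injective (tail env) x y u eq)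

head⁻-determines-binding : ∀ {Γ h₁ h₂ B₁ B₂} env → Γ ∋ h₁ ∶ B₁ → Γ ∋ h₂ ∶ B₂ → Unique (labsCtx Γ env) →
  head⁻ B₁ (env h₁ B₁) ≡ head⁻ B₂ (env h₂ B₂) → (h₁ ≡ h₂) × (B₁ ≡ B₂)
head⁻-determines-binding env x₁ x₂ u eq with head⁻-injective env x₁ x₂ u eq
... | refl = refl , ∋-functional x₁ x₂

remove : ℕ → Ctx → Ctx
remove n [] = []
remove zero (a ∷ Γ) = nothing ∷ Γ
remove (suc n) (a ∷ Γ) = a ∷ remove n Γ

labsCtx-remove : ∀ {Γ h B} env → Γ ∋ h ∶ B → labsCtx Γ env ↭ labs⁻ B (env h B) ++ labsCtx (remove h Γ) env
labsCtx-remove env az = ↭-refl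
labsCtx-remove {just A ∷ _} {suc n} {B} env (as x) =
  ↭-trans (++⁺ˡ (labs⁻ A (env zero A)) (labsCtx-remove _ x)) (shifts (labs⁻ A (env zero A)) (labs⁻ B (env (suc n) B)))
labsCtx-remove {nothing ∷ _} env (as x) = labsCtx-remove _ x

sub-remove : ∀ {Γ′ Δ Ε h B Γ} → Split Γ′ Δ Ε → Only Δ h B → Sub Γ′ Γ → Sub Ε (remove h Γ)
sub-remove (left s) (here _) (keep σ) = skip (sub-trans (split-subʳ s) σ)
sub-remove (right s) (there o) (keep σ) = keep (sub-remove s o σ)
sub-remove (none s) (there o) (drop σ) = drop (sub-remove s o σ)
sub-remove (none s) (there o) (skip σ) = skip (sub-remove s o σ)

-- The suffixes r₁, r₂ are needed because a spine's trace ends with its first argument's trace.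
mutual
  trace-injective : ∀ {Γ₁ Γ₂ Γ t₁ t₂ A} (N₁ : Nf Γ₁ t₁ A) (N₂ : Nf Γ₂ t₂ A) → Sub Γ₁ Γ → Sub Γ₂ Γ →
    ∀ env ℓ → Unique (labsCtx Γ env ++ labs⁺ A ℓ) → ∀ r₁ r₂ →
    trace N₁ env ℓ ++ r₁ ≡ trace N₂ env ℓ ++ r₂ → (t₁ ≡ t₂) × (r₁ ≡ r₂)
  trace-injective {Γ = Γ} (nlam {A = C} {B = B} n₁) (nlam n₂) σ₁ σ₂ env (ℓC , ℓB) u r₁ r₂ eq
    with trace-injective n₁ n₂ (keep σ₁) (keep σ₂) (extend C ℓC env) ℓB u′ r₁ r₂ eq
    where
    u′ : Unique (labsCtx (just C ∷ Γ) (extend C ℓC env) ++ labs⁺ B ℓB)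
    u′ = Unique-resp-↭ (↭-sym (labsCtx-extend Γ C ℓC env (labs⁺ B ℓB))) u
  ... | refl , refl = refl , refl
  trace-injective {Γ = Γ} (nne {h = h₁} {B₁} s₁ o₁ sp₁) (nne {h = h₂} {B₂} s₂ o₂ sp₂) σ₁ σ₂ env ℓ u r₁ r₂ eq
    with head⁻-determines-binding env x₁ x₂ (Unique-++⁻ˡ (labsCtx Γ env) u) (proj₁ (∷-injective eq))
    where
    x₁ : Γ ∋ h₁ ∶ B₁
    x₁ = only-sub⇒∋ o₁ (sub-trans (split-subˡ s₁) σ₁)
    x₂ : Γ ∋ h₂ ∶ B₂
    x₂ = only-sub⇒∋ o₂ (sub-trans (split-subˡ s₂) σ₂)
  ... | refl , refl
    with traceSpine-injective sp₁ sp₂ (sub-remove s₁ o₁ σ₁) (sub-remove s₂ o₂ σ₂) env (env h₁ B₁) u′ r₁ r₂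
           (proj₂ (∷-injective eq))
    where
    u′ : Unique (labsCtx (remove h₁ Γ) env ++ labs⁻ B₁ (env h₁ B₁))
    u′ = Unique-resp-↭ (↭-trans (↭-reflexive (++-identityʳ _))
           (↭-trans (labsCtx-remove env (only-sub⇒∋ o₁ (sub-trans (split-subˡ s₁) σ₁))) (++-comm (labs⁻ B₁ (env h₁ B₁)) _))) u
  ... | refl , refl = refl , refl

  traceSpine-injective : ∀ {Ε₁ Ε₂ Γ B us₁ us₂} (sp₁ : Spine Ε₁ B p us₁) (sp₂ : Spine Ε₂ B p us₂) → Sub Ε₁ Γ → Sub Ε₂ Γ →
    ∀ env ℓ → Unique (labsCtx Γ env ++ labs⁻ B ℓ) → ∀ r₁ r₂ →
    traceSpine sp₁ env ℓ ++ r₁ ≡ traceSpine sp₂ env ℓ ++ r₂ → (us₁ ≡ us₂) × (r₁ ≡ r₂)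
  traceSpine-injective (snil _) (snil _) σ₁ σ₂ env ℓ u r₁ r₂ eq = refl , eq
  traceSpine-injective {Γ = Γ} (scons {A = A} s₁ n₁ sp₁) (scons s₂ n₂ sp₂) σ₁ σ₂ env (ℓA , ℓB) u r₁ r₂ eq
    with traceSpine-injective sp₁ sp₂ (sub-trans (split-subʳ s₁) σ₁) (sub-trans (split-subʳ s₂) σ₂) env ℓB
           (Unique-drop-middle (labsCtx Γ env) (labs⁺ A ℓA) u) _ _
           (trans (sym (++-assoc (traceSpine sp₁ env ℓB) _ r₁)) (trans eq (++-assoc (traceSpine sp₂ env ℓB) _ r₂)))
  ... | refl , eq′ with trace-injective n₁ n₂ (sub-trans (split-subˡ s₁) σ₁) (sub-trans (split-subˡ s₂) σ₂) env ℓA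
           (Unique-drop-last (labsCtx Γ env) (labs⁺ A ℓA) u) r₁ r₂ eq′
  ... | refl , refl = refl , refl

-- Probes

Endo : Ty
Endo = p ⊸ p

I : Tm
I = lam p (var zero)

compose : Tm → Tm → Tm
compose d₂ d₁ = lam p (app (rename suc d₂) (app (rename suc d₁) (var zero)))

weaken³ : Tm → Tm
weaken³ t = rename suc (rename suc (rename suc t))

↑_ : (ℕ → Tm) → ℕ → Tm
(↑ κ) n = rename suc (κ n)

-- A label assignment κ : ℕ → Tm sends each label to an endomorphism of p. The probe for a
-- hypothesis of type B, fed its arguments and then x f g at type Bool, returns g (f (κ l (d x)))
-- for the head label l of B, where d composes the endomorphisms computed by its arguments.
mutual
  probe : ∀ B → Lab⁻ B → (ℕ → Tm) → Tm → Tm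
  probe p l κ d = lam p (lam Endo (lam Endo (app (var 0) (app (var 1) (app (weaken³ (κ l)) (app (weaken³ d) (var 2)))))))
  probe (C ⊸ B) (ℓC , ℓB) κ d = lam (C [ Bool /p]) (probe B ℓB (↑ κ) (compose (runEndo C ℓC (↑ κ) (var zero)) (rename suc d)))

  run : ∀ C → Lab⁺ C → (ℕ → Tm) → Tm → Tm → Tm
  run p _ κ y x = app (app (app y x) I) I
  run (C ⊸ B) (ℓC , ℓB) κ y x = run B ℓB κ (app y (probe C ℓC κ I)) x

  runEndo : ∀ C → Lab⁺ C → (ℕ → Tm) → Tm → Tm
  runEndo C ℓ κ y = lam p (run C ℓ (↑ κ) (rename suc y) (var zero))

↑-cong : ∀ {κ κ′} → κ ≗ κ′ → ↑ κ ≗ ↑ κ′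
↑-cong eq n = cong (rename suc) (eq n)

mutual
  probe-cong : ∀ B ℓ {κ κ′} d → κ ≗ κ′ → probe B ℓ κ d ≡ probe B ℓ κ′ d
  probe-cong p l d eq =
    cong (λ k → lam p (lam Endo (lam Endo (app (var 0) (app (var 1) (app (weaken³ k) (app (weaken³ d) (var 2)))))))) (eq l)
  probe-cong (C ⊸ B) (ℓC , ℓB) {κ′ = κ′} d eq = cong (lam (C [ Bool /p])) (trans (probe-cong B ℓB _ (↑-cong eq))
    (cong (λ e → probe B ℓB (↑ κ′) (compose e (rename suc d))) (runEndo-cong C ℓC (var zero) (↑-cong eq))))

  run-cong : ∀ C ℓ {κ κ′} y x → κ ≗ κ′ → run C ℓ κ y x ≡ run C ℓ κ′ y x
  run-cong p _ y x eq = refl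
  run-cong (C ⊸ B) (ℓC , ℓB) {κ′ = κ′} y x eq =
    trans (run-cong B ℓB _ x eq) (cong (λ a → run B ℓB κ′ (app y a) x) (probe-cong C ℓC I eq))

  runEndo-cong : ∀ C ℓ {κ κ′} y → κ ≗ κ′ → runEndo C ℓ κ y ≡ runEndo C ℓ κ′ y
  runEndo-cong C ℓ y eq = cong (lam p) (run-cong C ℓ _ (var zero) (↑-cong eq))

weaken³-subst : ∀ σ t → subst (exts (exts (exts σ))) (weaken³ t) ≡ weaken³ (subst σ t)
weaken³-subst σ t = trans (subst-exts-suc (exts (exts σ)) (rename suc (rename suc t)))
  (cong (rename suc) (trans (subst-exts-suc (exts σ) (rename suc t)) (cong (rename suc) (subst-exts-suc σ t))))

↑-subst : ∀ σ κ → subst (exts σ) ∘ ↑ κ ≗ ↑ (subst σ ∘ κ)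
↑-subst σ κ n = subst-exts-suc σ (κ n)

compose-subst : ∀ σ d₂ d₁ → subst σ (compose d₂ d₁) ≡ compose (subst σ d₂) (subst σ d₁)
compose-subst σ d₂ d₁ = cong₂ (λ a b → lam p (app a (app b (var zero)))) (subst-exts-suc σ d₂) (subst-exts-suc σ d₁)

mutual
  probe-subst : ∀ B ℓ σ κ d → subst σ (probe B ℓ κ d) ≡ probe B ℓ (subst σ ∘ κ) (subst σ d)
  probe-subst p l σ κ d = cong₂ (λ k e → lam p (lam Endo (lam Endo (app (var 0) (app (var 1) (app k (app e (var 2))))))))
    (weaken³-subst σ (κ l)) (weaken³-subst σ d)
  probe-subst (C ⊸ B) (ℓC , ℓB) σ κ d = cong (lam (C [ Bool /p])) (begin
    subst (exts σ) (probe B ℓB (↑ κ) (compose (runEndo C ℓC (↑ κ) (var zero)) (rename suc d)))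
      ≡⟨ probe-subst B ℓB (exts σ) (↑ κ) _ ⟩
    probe B ℓB (subst (exts σ) ∘ ↑ κ) (subst (exts σ) (compose (runEndo C ℓC (↑ κ) (var zero)) (rename suc d)))
      ≡⟨ probe-cong B ℓB _ (↑-subst σ κ) ⟩
    probe B ℓB (↑ (subst σ ∘ κ)) (subst (exts σ) (compose (runEndo C ℓC (↑ κ) (var zero)) (rename suc d)))
      ≡⟨ cong (probe B ℓB (↑ (subst σ ∘ κ))) (compose-subst (exts σ) (runEndo C ℓC (↑ κ) (var zero)) (rename suc d)) ⟩
    probe B ℓB (↑ (subst σ ∘ κ)) (compose (subst (exts σ) (runEndo C ℓC (↑ κ) (var zero))) (subst (exts σ) (rename suc d)))
      ≡⟨ cong₂ (λ e d′ → probe B ℓB (↑ (subst σ ∘ κ)) (compose e d′))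
           (trans (runEndo-subst C ℓC (exts σ) (↑ κ) (var zero)) (runEndo-cong C ℓC (var zero) (↑-subst σ κ)))
           (subst-exts-suc σ d) ⟩
    probe B ℓB (↑ (subst σ ∘ κ)) (compose (runEndo C ℓC (↑ (subst σ ∘ κ)) (var zero)) (rename suc (subst σ d)))
      ∎)
    where open ≡-Reasoning

  run-subst : ∀ C ℓ σ κ y x → subst σ (run C ℓ κ y x) ≡ run C ℓ (subst σ ∘ κ) (subst σ y) (subst σ x)
  run-subst p _ σ κ y x = refl
  run-subst (C ⊸ B) (ℓC , ℓB) σ κ y x = trans (run-subst B ℓB σ κ _ x)
    (cong (λ a → run B ℓB (subst σ ∘ κ) (app (subst σ y) a) (subst σ x)) (probe-subst C ℓC σ κ I))

  runEndo-subst : ∀ C ℓ σ κ y → subst σ (runEndo C ℓ κ y) ≡ runEndo C ℓ (subst σ ∘ κ) (subst σ y)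
  runEndo-subst C ℓ σ κ y = cong (lam p) (trans (run-subst C ℓ (exts σ) (↑ κ) _ (var zero))
    (trans (run-cong C ℓ _ _ (↑-subst σ κ)) (cong (λ z → run C ℓ (↑ (subst σ ∘ κ)) z (var zero)) (subst-exts-suc σ y))))

args³ : Tm → Tm → Tm → ℕ → Tm
args³ x f g = g • f • x • var

β³ : ∀ {A B C b x f g} → app (app (app (lam A (lam B (lam C b))) x) f) g ≈βη subst (args³ x f g) b
β³ {b = b} {x} {f} {g} =
  ≈trans (ξappˡ (ξappˡ β)) (≈trans (ξappˡ β) (≈trans β (≡⇒≈βη (trans (cong (_[ g ]) (subst-subst _ _ b))
    (trans (subst-subst _ _ b) (subst-cong args b))))))
  where
  args : ∀ n → subst (exts (single f)) (exts (exts (single x)) n) [ g ] ≡ args³ x f g n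
  args zero = refl
  args (suc zero) = rename-suc-[] f g
  args (suc (suc zero)) = trans (cong (_[ g ]) (subst-exts-suc (single f) (rename suc x)))
    (trans (rename-suc-[] _ g) (rename-suc-[] x f))
  args (suc (suc (suc n))) = refl

args³-weaken³ : ∀ x f g t → subst (args³ x f g) (weaken³ t) ≡ t
args³-weaken³ x f g t = trans (subst-rename suc _ (rename suc (rename suc t)))
  (trans (subst-rename suc _ (rename suc t)) (trans (subst-rename suc _ t) (subst-var t)))

↑-[] : ∀ u κ → (_[ u ]) ∘ ↑ κ ≗ κ
↑-[] u κ n = rename-suc-[] (κ n) u

probe-p-β : ∀ l κ d x f g → app (app (app (probe p l κ d) x) f) g ≈βη app g (app f (app (κ l) (app d x)))
probe-p-β l κ d x f g =
  ≈trans β³ (≡⇒≈βη (cong₂ (λ k e → app g (app f (app k (app e x)))) (args³-weaken³ x f g (κ l)) (args³-weaken³ x f g d)))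

probe-⊸-β : ∀ C B ℓC ℓB κ d u → app (probe (C ⊸ B) (ℓC , ℓB) κ d) u ≈βη probe B ℓB κ (compose (runEndo C ℓC κ u) d)
probe-⊸-β C B ℓC ℓB κ d u = ≈trans β (≡⇒≈βη (begin
  probe B ℓB (↑ κ) (compose (runEndo C ℓC (↑ κ) (var zero)) (rename suc d)) [ u ]
    ≡⟨ probe-subst B ℓB (single u) (↑ κ) _ ⟩
  probe B ℓB ((_[ u ]) ∘ ↑ κ) (compose (runEndo C ℓC (↑ κ) (var zero)) (rename suc d) [ u ])
    ≡⟨ probe-cong B ℓB _ (↑-[] u κ) ⟩
  probe B ℓB κ (compose (runEndo C ℓC (↑ κ) (var zero)) (rename suc d) [ u ])
    ≡⟨ cong (probe B ℓB κ) (compose-subst (single u) (runEndo C ℓC (↑ κ) (var zero)) (rename suc d)) ⟩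
  probe B ℓB κ (compose (runEndo C ℓC (↑ κ) (var zero) [ u ]) (rename suc d [ u ]))
    ≡⟨ cong₂ (λ e d′ → probe B ℓB κ (compose e d′))
         (trans (runEndo-subst C ℓC (single u) (↑ κ) (var zero)) (runEndo-cong C ℓC u (↑-[] u κ)))
         (rename-suc-[] d u) ⟩
  probe B ℓB κ (compose (runEndo C ℓC κ u) d)
    ∎))
  where open ≡-Reasoning

runEndo-β : ∀ C ℓ κ y x → app (runEndo C ℓ κ y) x ≈βη run C ℓ κ y x
runEndo-β C ℓ κ y x = ≈trans β (≡⇒≈βη (trans (run-subst C ℓ (single x) (↑ κ) (rename suc y) (var zero))
  (trans (run-cong C ℓ _ _ (↑-[] x κ)) (cong (λ z → run C ℓ κ z x) (rename-suc-[] y x)))))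

compose-β : ∀ d₂ d₁ x → app (compose d₂ d₁) x ≈βη app d₂ (app d₁ x)
compose-β d₂ d₁ x = ≈trans β (≡⇒≈βη (cong₂ (λ a b → app a (app b x)) (rename-suc-[] d₂ x) (rename-suc-[] d₁ x)))

run-congʸ : ∀ C ℓ κ {y y′} x → y ≈βη y′ → run C ℓ κ y x ≈βη run C ℓ κ y′ x
run-congʸ p _ κ x eq = ξappˡ (ξappˡ (ξappˡ eq))
run-congʸ (C ⊸ B) (ℓC , ℓB) κ x eq = run-congʸ B ℓB κ x (ξappˡ eq)

run-congˣ : ∀ C ℓ κ y {x x′} → x ≈βη x′ → run C ℓ κ y x ≈βη run C ℓ κ y x′
run-congˣ p _ κ y eq = ξappˡ (ξappˡ (ξappʳ eq))
run-congˣ (C ⊸ B) (ℓC , ℓB) κ y eq = run-congˣ B ℓB κ _ eq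

word : (ℕ → Tm) → List ℕ → Tm → Tm
word κ [] x = x
word κ (l ∷ w) x = app (κ l) (word κ w x)

word-++ : ∀ κ w₁ w₂ x → word κ (w₁ ++ w₂) x ≡ word κ w₁ (word κ w₂ x)
word-++ κ [] w₂ x = refl
word-++ κ (l ∷ w₁) w₂ x = cong (app (κ l)) (word-++ κ w₁ w₂ x)

Computes : (ℕ → Tm) → Tm → List ℕ → Set
Computes κ d w = ∀ x → app d x ≈βη word κ w x

Agree : Ctx → Env → (ℕ → Tm) → (ℕ → Tm) → Set
Agree Γ env σ κ = ∀ {n B} → Γ ∋ n ∶ B → σ n ≡ probe B (env n B) κ I

agree-sub : ∀ {Δ Γ env σ κ} → Sub Δ Γ → Agree Γ env σ κ → Agree Δ env σ κ
agree-sub s ag x = ag (∋-sub x s)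

agree-extend : ∀ {Γ env σ κ} C ℓ → Agree Γ env σ κ → Agree (just C ∷ Γ) (extend C ℓ env) (probe C ℓ κ I • σ) κ
agree-extend C ℓ ag az = cong (λ ℓ′ → probe C ℓ′ _ I) (sym (cast⁻-id C ℓ))
agree-extend C ℓ ag (as x) = ag x

mutual
  run-nf : ∀ {Γ t A} (N : Nf Γ t A) env σ κ → Agree Γ env σ κ → ∀ ℓ x →
    run A ℓ κ (subst σ (tsub Bool t)) x ≈βη word κ (trace N env ℓ) x
  run-nf (nlam {A = C} {B} {t} n) env σ κ ag (ℓC , ℓB) x = begin
    run B ℓB κ (app (lam (C [ Bool /p]) (subst (exts σ) (tsub Bool t))) (probe C ℓC κ I)) x
      ≈⟨ run-congʸ B ℓB κ x β ⟩
    run B ℓB κ (subst (exts σ) (tsub Bool t) [ probe C ℓC κ I ]) x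
      ≡⟨ cong (λ y → run B ℓB κ y x) (exts-[] σ (tsub Bool t) (probe C ℓC κ I)) ⟩
    run B ℓB κ (subst (probe C ℓC κ I • σ) (tsub Bool t)) x
      ≈⟨ run-nf n (extend C ℓC env) _ κ (agree-extend C ℓC ag) ℓB x ⟩
    word κ (trace n (extend C ℓC env) ℓB) x
      ∎
    where open ≈βη-Reasoning
  run-nf (nne {h = h} {B} {us} s o sp) env σ κ ag _ x = begin
    run p tt κ (subst σ (tsub Bool (apps (var h) us))) x
      ≡⟨ cong (λ y → run p tt κ y x) applied-head ⟩
    run p tt κ (apps (probe B (env h B) κ I) (map (subst σ ∘ tsub Bool) us)) x
      ≈⟨ run-spine sp env σ κ (agree-sub (split-subʳ s) ag) (env h B) I [] (λ _ → β) x ⟩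
    word κ (head⁻ B (env h B) ∷ traceSpine sp env (env h B) ++ []) x
      ≡⟨ cong (λ w → word κ (head⁻ B (env h B) ∷ w) x) (++-identityʳ _) ⟩
    word κ (head⁻ B (env h B) ∷ traceSpine sp env (env h B)) x
      ∎
    where
    open ≈βη-Reasoning
    applied-head : subst σ (tsub Bool (apps (var h) us)) ≡ apps (probe B (env h B) κ I) (map (subst σ ∘ tsub Bool) us)
    applied-head = trans (subst-tsub-apps σ Bool (var h) us)
      (cong (λ a → apps a (map (subst σ ∘ tsub Bool) us)) (ag (only-sub⇒∋ o (split-subˡ s))))

  run-spine : ∀ {Ε B us} (sp : Spine Ε B p us) env σ κ → Agree Ε env σ κ → ∀ ℓ d w → Computes κ d w → ∀ x →
    run p tt κ (apps (probe B ℓ κ d) (map (subst σ ∘ tsub Bool) us)) x ≈βη word κ (head⁻ B ℓ ∷ traceSpine sp env ℓ ++ w) x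
  run-spine (snil _) env σ κ ag l d w d-computes x = begin
    app (app (app (probe p l κ d) x) I) I  ≈⟨ probe-p-β l κ d x I I ⟩
    app I (app I (app (κ l) (app d x)))    ≈⟨ β ⟩
    app I (app (κ l) (app d x))            ≈⟨ β ⟩
    app (κ l) (app d x)                    ≈⟨ ξappʳ (d-computes x) ⟩
    app (κ l) (word κ w x)                 ∎
    where open ≈βη-Reasoning
  run-spine (scons {A = C} {B} {u = u} {us} s n sp) env σ κ ag (ℓC , ℓB) d w d-computes x = begin
    run p tt κ (apps (app (probe (C ⊸ B) (ℓC , ℓB) κ d) u′) us′) x
      ≈⟨ run-congʸ p tt κ x (apps-congˡ us′ (probe-⊸-β C B ℓC ℓB κ d u′)) ⟩
    run p tt κ (apps (probe B ℓB κ (compose (runEndo C ℓC κ u′) d)) us′) x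
      ≈⟨ run-spine sp env σ κ (agree-sub (split-subʳ s) ag) ℓB _ (trace n env ℓC ++ w) composed-computes x ⟩
    word κ (head⁻ B ℓB ∷ traceSpine sp env ℓB ++ trace n env ℓC ++ w) x
      ≡⟨ cong (λ w′ → word κ (head⁻ B ℓB ∷ w′) x) (sym (++-assoc (traceSpine sp env ℓB) (trace n env ℓC) w)) ⟩
    word κ (head⁻ B ℓB ∷ (traceSpine sp env ℓB ++ trace n env ℓC) ++ w) x
      ∎
    where
    open ≈βη-Reasoning
    u′ : Tm
    u′ = subst σ (tsub Bool u)
    us′ : List Tm
    us′ = map (subst σ ∘ tsub Bool) us
    composed-computes : Computes κ (compose (runEndo C ℓC κ u′) d) (trace n env ℓC ++ w)
    composed-computes y = begin
      app (compose (runEndo C ℓC κ u′) d) y  ≈⟨ compose-β _ d y ⟩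
      app (runEndo C ℓC κ u′) (app d y)      ≈⟨ runEndo-β C ℓC κ u′ (app d y) ⟩
      run C ℓC κ u′ (app d y)                ≈⟨ run-congˣ C ℓC κ u′ (d-computes y) ⟩
      run C ℓC κ u′ (word κ w y)             ≈⟨ run-nf n env σ κ (agree-sub (split-subˡ s) ag) ℓC (word κ w y) ⟩
      word κ (trace n env ℓC) (word κ w y)   ≡⟨ sym (word-++ κ (trace n env ℓC) w y) ⟩
      word κ (trace n env ℓC ++ w) y         ∎

-- κ is linearly typable: M L is the context of the free variables of the κ l with l ∈ L.
record LinearAssignment (M : List ℕ → Ctx) (κ : ℕ → Tm) : Set where
  field
    split-disjoint : ∀ L₁ L₂ → Unique (L₁ ++ L₂) → Split (M (L₁ ++ L₂)) (M L₁) (M L₂)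
    empty-[] : Empty (M [])
    typed : ∀ l → M (l ∷ []) ⊢ κ l ∶ Endo
open LinearAssignment

↑-linear : ∀ {M κ} → LinearAssignment M κ → LinearAssignment (λ L → nothing ∷ M L) (↑ κ)
split-disjoint (↑-linear lin) L₁ L₂ u = none (split-disjoint lin L₁ L₂ u)
empty-[] (↑-linear lin) = refl ∷ empty-[] lin
typed (↑-linear lin) l = weaken-typed (typed lin l)

weaken³-typed : ∀ {Γ t A} → Γ ⊢ t ∶ A → nothing ∷ nothing ∷ nothing ∷ Γ ⊢ weaken³ t ∶ A
weaken³-typed d = weaken-typed (weaken-typed (weaken-typed d))

I-typed : ∀ {Γ} → Empty Γ → Γ ⊢ I ∶ Endo
I-typed e = ⊢lam (⊢var (here e))

compose-typed : ∀ {Γ Δ Ε d₂ d₁} → Δ ⊢ d₂ ∶ Endo → Ε ⊢ d₁ ∶ Endo → Split Γ Δ Ε → Γ ⊢ compose d₂ d₁ ∶ Endo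
compose-typed {Ε = Ε} d₂ d₁ s = ⊢lam (⊢app (right s) (weaken-typed d₂)
  (⊢app (right (split-erase Ε)) (weaken-typed d₁) (⊢var (here (erase-empty Ε)))))

mutual
  probe-typed : ∀ {M κ} → LinearAssignment M κ → ∀ B ℓ {Γ Δ d} → Unique (labs⁻ B ℓ) → Δ ⊢ d ∶ Endo →
    Split Γ (M (labs⁻ B ℓ)) Δ → Γ ⊢ probe B ℓ κ d ∶ B [ Bool /p]
  probe-typed lin p l {Γ} {Δ} u d s =
    ⊢lam (⊢lam (⊢lam (⊢app (left (right (right (split-comm (split-erase Γ))))) (⊢var (here (refl ∷ refl ∷ erase-empty Γ)))
      (⊢app (none (left (right (split-comm (split-erase Γ))))) (⊢var (there (here (refl ∷ erase-empty Γ))))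
        (⊢app (none (none (right s))) (weaken³-typed (typed lin l))
          (⊢app (none (none (right (split-erase Δ)))) (weaken³-typed d)
            (⊢var (there (there (here (erase-empty Δ)))))))))))
  probe-typed {M} lin (C ⊸ B) (ℓC , ℓB) u d s
    with split-exchange s (split-disjoint lin (labs⁺ C ℓC) (labs⁻ B ℓB) u)
  ... | _ , s₁ , s₂ = ⊢lam (probe-typed (↑-linear lin) B ℓB (Unique-++⁻ʳ (labs⁺ C ℓC) u)
          (compose-typed (runEndo-typed (↑-linear lin) C ℓC (Unique-++⁻ˡ (labs⁺ C ℓC) u) (⊢var (here (erase-empty (M (labs⁺ C ℓC)))))
                           (right (split-erase (M (labs⁺ C ℓC)))))
                         (weaken-typed d) (left s₁))
          (right (split-comm s₂)))

  run-typed : ∀ {M κ} → LinearAssignment M κ → ∀ C ℓ {Γ Γ′ Δ Ε y x} → Unique (labs⁺ C ℓ) → Δ ⊢ y ∶ C [ Bool /p] → Ε ⊢ x ∶ p →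
    Split Γ′ (M (labs⁺ C ℓ)) Δ → Split Γ Γ′ Ε → Γ ⊢ run C ℓ κ y x ∶ p
  run-typed lin p _ {Γ} u y x s₁ s rewrite split-emptyˡ s₁ (empty-[] lin) =
    ⊢app (split-erase Γ) (⊢app (split-erase Γ) (⊢app s y x) (I-typed (erase-empty Γ))) (I-typed (erase-empty Γ))
  run-typed {M} lin (C ⊸ B) (ℓC , ℓB) u y x s₁ s
    with split-exchange s₁ (split-disjoint lin (labs⁻ C ℓC) (labs⁺ B ℓB) u)
  ... | _ , s₂ , s₃ = run-typed lin B ℓB (Unique-++⁻ʳ (labs⁻ C ℓC) u)
          (⊢app (split-comm s₂) y (probe-typed lin C ℓC (Unique-++⁻ˡ (labs⁻ C ℓC) u) (I-typed (erase-empty (M (labs⁻ C ℓC)))) (split-erase _)))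
          x (split-comm s₃) s

  runEndo-typed : ∀ {M κ} → LinearAssignment M κ → ∀ C ℓ {Γ Δ y} → Unique (labs⁺ C ℓ) → Δ ⊢ y ∶ C [ Bool /p] →
    Split Γ (M (labs⁺ C ℓ)) Δ → Γ ⊢ runEndo C ℓ κ y ∶ Endo
  runEndo-typed lin C ℓ {Γ} u y s =
    ⊢lam (run-typed (↑-linear lin) C ℓ u (weaken-typed y) (⊢var (here (erase-empty Γ))) (none s) (right (split-erase Γ)))

-- Discordant pairs of labels

record Discordant (w₁ w₂ : List ℕ) : Set where
  constructor discordant
  field
    i j : ℕ
    P Q R P′ Q′ R′ : List ℕ
    w₁-split : w₁ ≡ P ++ j ∷ Q ++ i ∷ R
    w₂-split : w₂ ≡ P′ ++ i ∷ Q′ ++ j ∷ R′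

∈-∷-≢ : ∀ {X : Set} {x y : X} {xs} → x ∈ y ∷ xs → x ≢ y → x ∈ xs
∈-∷-≢ (here refl) x≢y = ⊥-elim (x≢y refl)
∈-∷-≢ (there x∈xs) _ = x∈xs

↭-≢⇒discordant : ∀ (w₁ w₂ : List ℕ) → w₁ ↭ w₂ → w₁ ≢ w₂ → Discordant w₁ w₂
↭-≢⇒discordant [] [] _ w₁≢w₂ = ⊥-elim (w₁≢w₂ refl)
↭-≢⇒discordant [] (_ ∷ _) q _ with ↭-length q
... | ()
↭-≢⇒discordant (_ ∷ _) [] q _ with ↭-length q
... | ()
↭-≢⇒discordant (x ∷ w₁) (y ∷ w₂) q w₁≢w₂ with x ≟ y
... | yes refl with ↭-≢⇒discordant w₁ w₂ (drop-∷ q) (λ eq → w₁≢w₂ (cong (x ∷_) eq))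
...   | discordant i j P Q R P′ Q′ R′ eq₁ eq₂ =
  discordant i j (x ∷ P) Q R (x ∷ P′) Q′ R′ (cong (x ∷_) eq₁) (cong (x ∷_) eq₂)
↭-≢⇒discordant (x ∷ w₁) (y ∷ w₂) q _ | no x≢y
  with ∈-∃++ (∈-∷-≢ (Any-resp-↭ (↭-sym q) (here refl)) (x≢y ∘ sym)) | ∈-∃++ (∈-∷-≢ (Any-resp-↭ q (here refl)) x≢y)
... | Q , R , eq₁ | Q′ , R′ , eq₂ = discordant y x [] Q R [] Q′ R′ (cong (x ∷_) eq₁) (cong (y ∷_) eq₂)

Unique⇒two-apart : ∀ {X : Set} P (a : X) Q b R → Unique (P ++ a ∷ Q ++ b ∷ R) → a ≢ b × All (λ l → l ≢ a × l ≢ b) (P ++ Q ++ R)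
Unique⇒two-apart P a Q b R u with Unique-resp-↭ front u
  where
  open PermutationReasoning
  front : P ++ a ∷ Q ++ b ∷ R ↭ a ∷ b ∷ P ++ Q ++ R
  front = begin
    P ++ a ∷ Q ++ b ∷ R     ↭⟨ shift a P (Q ++ b ∷ R) ⟩
    a ∷ P ++ Q ++ b ∷ R     ≡⟨ cong (a ∷_) (sym (++-assoc P Q (b ∷ R))) ⟩
    a ∷ (P ++ Q) ++ b ∷ R   ↭⟨ ↭-prep a (shift b (P ++ Q) R) ⟩
    a ∷ b ∷ (P ++ Q) ++ R   ≡⟨ cong (λ w → a ∷ b ∷ w) (++-assoc P Q R) ⟩
    a ∷ b ∷ P ++ Q ++ R     ∎
... | (a≢b ∷ a≢rest) ∷ b≢rest ∷ _ = a≢b , All.zipWith (λ (a≢l , b≢l) → a≢l ∘ sym , b≢l ∘ sym) (a≢rest , b≢rest)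

interval : ℕ → ℕ → List ℕ
interval n zero = []
interval n (suc k) = n ∷ interval (suc n) k

interval-++ : ∀ n a b → interval n a ++ interval (n + a) b ≡ interval n (a + b)
interval-++ n zero b = cong (λ m → interval m b) (+-identityʳ n)
interval-++ n (suc a) b = cong (n ∷_) (trans (cong (λ m → interval (suc n) a ++ interval m b) (+-suc n a)) (interval-++ (suc n) a b))

interval-above : ∀ n m k → n < m → All (n ≢_) (interval m k)
interval-above n m zero _ = []
interval-above n m (suc k) n<m = <⇒≢ n<m ∷ interval-above n (suc m) k (m<n⇒m<1+n n<m)

interval-unique : ∀ n k → Unique (interval n k)
interval-unique n zero = []
interval-unique n (suc k) = interval-above n (suc n) k ≤-refl ∷ interval-unique (suc n) k

mutual
  count⁻ : Ty → ℕ
  count⁻ p = 1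
  count⁻ (A ⊸ B) = count⁺ A + count⁻ B

  count⁺ : Ty → ℕ
  count⁺ p = 0
  count⁺ (A ⊸ B) = count⁻ A + count⁺ B

mutual
  fresh⁻ : ∀ A → ℕ → Lab⁻ A
  fresh⁻ p n = n
  fresh⁻ (A ⊸ B) n = fresh⁺ A n , fresh⁻ B (n + count⁺ A)

  fresh⁺ : ∀ A → ℕ → Lab⁺ A
  fresh⁺ p n = tt
  fresh⁺ (A ⊸ B) n = fresh⁻ A n , fresh⁺ B (n + count⁻ A)

mutual
  labs⁻-fresh⁻ : ∀ A n → labs⁻ A (fresh⁻ A n) ≡ interval n (count⁻ A)
  labs⁻-fresh⁻ p n = refl
  labs⁻-fresh⁻ (A ⊸ B) n =
    trans (cong₂ _++_ (labs⁺-fresh⁺ A n) (labs⁻-fresh⁻ B (n + count⁺ A))) (interval-++ n (count⁺ A) (count⁻ B))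

  labs⁺-fresh⁺ : ∀ A n → labs⁺ A (fresh⁺ A n) ≡ interval n (count⁺ A)
  labs⁺-fresh⁺ p n = refl
  labs⁺-fresh⁺ (A ⊸ B) n =
    trans (cong₂ _++_ (labs⁻-fresh⁻ A n) (labs⁺-fresh⁺ B (n + count⁻ A))) (interval-++ n (count⁻ A) (count⁺ B))

fresh⁺-unique : ∀ A → Unique (labs⁺ A (fresh⁺ A 0))
fresh⁺-unique A = ≡-subst Unique (sym (labs⁺-fresh⁺ A 0)) (interval-unique 0 (count⁺ A))

env₀ : Env
env₀ _ = default⁻

trace₀ : ∀ {t A} → Nf [] t A → List ℕ
trace₀ {A = A} N = trace N env₀ (fresh⁺ A 0)

trace₀-↭ : ∀ {t A} (N : Nf [] t A) → trace₀ N ↭ labs⁺ A (fresh⁺ A 0)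
trace₀-↭ N = trace-↭ N env₀ _

trace₀-injective : ∀ {t₁ t₂ A} (N₁ : Nf [] t₁ A) (N₂ : Nf [] t₂ A) → trace₀ N₁ ≡ trace₀ N₂ → t₁ ≡ t₂
trace₀-injective {A = A} N₁ N₂ eq =
  proj₁ (trace-injective N₁ N₂ [] [] env₀ _ (fresh⁺-unique A) [] [] (cong (_++ []) eq))

trace₀-unique : ∀ {t A} (N : Nf [] t A) → Unique (trace₀ N)
trace₀-unique {A = A} N = Unique-resp-↭ (↭-sym (trace₀-↭ N)) (fresh⁺-unique A)

word-identity : ∀ κ w x → All (λ l → κ l ≡ I) w → word κ w x ≈βη x
word-identity κ [] x [] = ≈refl
word-identity κ (l ∷ w) x (κl≡I ∷ κw≡I) =
  ≈trans (≡⇒≈βη (cong (λ k → app k (word κ w x)) κl≡I)) (≈trans β (word-identity κ w x κw≡I))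

word-two : ∀ κ P a Q b R x → All (λ l → κ l ≡ I) (P ++ Q ++ R) → word κ (P ++ a ∷ Q ++ b ∷ R) x ≈βη app (κ a) (app (κ b) x)
word-two κ P a Q b R x idle with All.++⁻ P idle
... | idle-P , idle-QR with All.++⁻ Q idle-QR
... | idle-Q , idle-R = begin
  word κ (P ++ a ∷ Q ++ b ∷ R) x                                ≡⟨ word-++ κ P _ x ⟩
  word κ P (app (κ a) (word κ (Q ++ b ∷ R) x))                  ≡⟨ cong (λ y → word κ P (app (κ a) y)) (word-++ κ Q _ x) ⟩
  word κ P (app (κ a) (word κ Q (app (κ b) (word κ R x))))      ≈⟨ word-identity κ P _ idle-P ⟩
  app (κ a) (word κ Q (app (κ b) (word κ R x)))                 ≈⟨ ξappʳ (word-identity κ Q _ idle-Q) ⟩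
  app (κ a) (app (κ b) (word κ R x))                            ≈⟨ ξappʳ (ξappʳ (word-identity κ R x idle-R)) ⟩
  app (κ a) (app (κ b) x)                                       ∎
  where open ≈βη-Reasoning

weaken³-as-subst : ∀ t → weaken³ t ≡ subst (λ n → var (suc (suc (suc n)))) t
weaken³-as-subst t =
  trans (cong (rename suc) (rename-rename suc suc t)) (trans (rename-rename (suc ∘ suc) suc t) (rename-as-subst _ t))

weaken³-≈βη : ∀ {t u} → t ≈βη u → weaken³ t ≈βη weaken³ u
weaken³-≈βη e = rename-≈βη suc (rename-≈βη suc (rename-≈βη suc e))

slot : ℕ → List ℕ → Maybe Ty
slot x L with x ∈? L
... | yes _ = just Endo
... | no _ = nothing

slot-∈ : ∀ {x L} → x ∈ L → slot x L ≡ just Endo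
slot-∈ {x} {L} x∈L with x ∈? L
... | yes _ = refl
... | no x∉L = ⊥-elim (x∉L x∈L)

slot-∉ : ∀ {x L} → x ∉ L → slot x L ≡ nothing
slot-∉ {x} {L} x∉L with x ∈? L
... | yes x∈L = ⊥-elim (x∉L x∈L)
... | no _ = refl

slot-split : ∀ x L₁ L₂ {Γ Δ Ε} → Unique (L₁ ++ L₂) → Split Γ Δ Ε →
  Split (slot x (L₁ ++ L₂) ∷ Γ) (slot x L₁ ∷ Δ) (slot x L₂ ∷ Ε)
slot-split x L₁ L₂ u s with x ∈? L₁ | x ∈? L₂ | x ∈? (L₁ ++ L₂)
... | yes x∈L₁ | yes x∈L₂ | _ = ⊥-elim (Unique-++⇒disjoint L₁ u x∈L₁ x∈L₂)
... | yes _ | no _ | yes _ = left s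
... | yes x∈L₁ | no _ | no x∉L = ⊥-elim (x∉L (∈-++⁺ˡ x∈L₁))
... | no _ | yes _ | yes _ = right s
... | no _ | yes x∈L₂ | no x∉L = ⊥-elim (x∉L (∈-++⁺ʳ L₁ x∈L₂))
... | no x∉L₁ | no x∉L₂ | yes x∈L = ⊥-elim ([ x∉L₁ , x∉L₂ ]′ (∈-++⁻ L₁ x∈L))
... | no _ | no _ | no _ = none s

∉-[-] : ∀ {x y : ℕ} → x ≢ y → x ∉ y ∷ []
∉-[-] x≢y (here x≡y) = x≢y x≡y

-- Inside λ x f g, f is variable 1 and g is variable 0; the hole is variable 3.
module Separator (i j : ℕ) (i≢j : i ≢ j) where

  marks : ℕ → Tm
  marks l with l ≟ i | l ≟ j
  ... | yes _ | _ = var 1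
  ... | no _ | yes _ = var 0
  ... | no _ | no _ = I

  marks-i : marks i ≡ var 1
  marks-i with i ≟ i | i ≟ j
  ... | yes _ | _ = refl
  ... | no i≢i | _ = ⊥-elim (i≢i refl)

  marks-j : marks j ≡ var 0
  marks-j with j ≟ i | j ≟ j
  ... | yes j≡i | _ = ⊥-elim (i≢j (sym j≡i))
  ... | no _ | yes _ = refl
  ... | no _ | no j≢j = ⊥-elim (j≢j refl)

  marks-other : ∀ {l} → l ≢ i → l ≢ j → marks l ≡ I
  marks-other {l} l≢i l≢j with l ≟ i | l ≟ j
  ... | yes l≡i | _ = ⊥-elim (l≢i l≡i)
  ... | no _ | yes l≡j = ⊥-elim (l≢j l≡j)
  ... | no _ | no _ = refl

  marks-subst : ∀ σ l → subst (exts (exts σ)) (marks l) ≡ marks l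
  marks-subst σ l with l ≟ i | l ≟ j
  ... | yes _ | _ = refl
  ... | no _ | yes _ = refl
  ... | no _ | no _ = refl

  slots : Maybe Ty → Maybe Ty → Ctx
  slots g f = g ∷ f ∷ nothing ∷ nothing ∷ []

  resources : List ℕ → Ctx
  resources L = slots (slot j L) (slot i L)

  marks-linear : LinearAssignment resources marks
  split-disjoint marks-linear L₁ L₂ u = slot-split j L₁ L₂ u (slot-split i L₁ L₂ u (none (none [])))
  empty-[] marks-linear = refl ∷ refl ∷ refl ∷ refl ∷ []
  typed marks-linear l with l ≟ i | l ≟ j
  ... | yes refl | _ = ≡-subst (λ Γ → Γ ⊢ var 1 ∶ Endo)
    (cong₂ slots (sym (slot-∉ (∉-[-] (i≢j ∘ sym)))) (sym (slot-∈ (here refl))))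
    (⊢var (there (here (refl ∷ refl ∷ []))))
  ... | no l≢i | yes refl = ≡-subst (λ Γ → Γ ⊢ var 0 ∶ Endo)
    (cong₂ slots (sym (slot-∈ (here refl))) (sym (slot-∉ (∉-[-] (l≢i ∘ sym)))))
    (⊢var (here (refl ∷ refl ∷ refl ∷ [])))
  ... | no l≢i | no l≢j = ≡-subst (λ Γ → Γ ⊢ I ∶ Endo)
    (cong₂ slots (sym (slot-∉ (∉-[-] (l≢j ∘ sym)))) (sym (slot-∉ (∉-[-] (l≢i ∘ sym)))))
    (I-typed (refl ∷ refl ∷ refl ∷ refl ∷ []))

  separator : ∀ A → Lab⁺ A → Tm
  separator A ℓ = lam p (lam Endo (lam Endo (run A ℓ marks (var 3) (var 2))))

  separator-typed : ∀ A ℓ → Unique (labs⁺ A ℓ) → i ∈ labs⁺ A ℓ → j ∈ labs⁺ A ℓ →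
    OneHole (separator A ℓ) (A [ Bool /p]) Bool
  separator-typed A ℓ u i∈ j∈ = ⊢lam (⊢lam (⊢lam
    (run-typed marks-linear A ℓ u (⊢var (there (there (there (here []))))) (⊢var (there (there (here (refl ∷ [])))))
      marks-and-hole (left (left (right (left [])))))))
    where
    marks-and-hole : Split (just Endo ∷ just Endo ∷ nothing ∷ just (A [ Bool /p]) ∷ []) (resources (labs⁺ A ℓ))
                           (nothing ∷ nothing ∷ nothing ∷ just (A [ Bool /p]) ∷ [])
    marks-and-hole = ≡-subst (λ Γ → Split (just Endo ∷ just Endo ∷ nothing ∷ just (A [ Bool /p]) ∷ []) Γ
                                         (nothing ∷ nothing ∷ nothing ∷ just (A [ Bool /p]) ∷ []))
      (cong₂ slots (sym (slot-∈ j∈)) (sym (slot-∈ i∈))) (left (left (none (right []))))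

  plug-separator : ∀ {A t} ℓ Θ (N : Nf [] t A) → Θ ≈βη t →
    plug (separator A ℓ) (tsub Bool Θ) ≈βη lam p (lam Endo (lam Endo (word marks (trace N env₀ ℓ) (var 2))))
  plug-separator {A} {t} ℓ Θ N Θ≈t = ξlam (ξlam (ξlam (begin
    subst (exts (exts (exts (single (tsub Bool Θ))))) (run A ℓ marks (var 3) (var 2))
      ≡⟨ run-subst A ℓ _ marks (var 3) (var 2) ⟩
    run A ℓ (subst (exts (exts (exts (single (tsub Bool Θ))))) ∘ marks) (weaken³ (tsub Bool Θ)) (var 2)
      ≡⟨ run-cong A ℓ _ (var 2) (marks-subst _) ⟩
    run A ℓ marks (weaken³ (tsub Bool Θ)) (var 2)
      ≈⟨ run-congʸ A ℓ marks (var 2) (weaken³-≈βη (tsub-≈βη Bool Θ≈t)) ⟩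
    run A ℓ marks (weaken³ (tsub Bool t)) (var 2)
      ≡⟨ cong (λ y → run A ℓ marks y (var 2)) (weaken³-as-subst (tsub Bool t)) ⟩
    run A ℓ marks (subst (λ n → var (suc (suc (suc n)))) (tsub Bool t)) (var 2)
      ≈⟨ run-nf N env₀ _ marks (λ ()) ℓ (var 2) ⟩
    word marks (trace N env₀ ℓ) (var 2)
      ∎)))
    where open ≈βη-Reasoning

  word-j-i : ∀ P Q R x → Unique (P ++ j ∷ Q ++ i ∷ R) → word marks (P ++ j ∷ Q ++ i ∷ R) x ≈βη app (var 0) (app (var 1) x)
  word-j-i P Q R x u =
    ≈trans (word-two marks P j Q i R x (All.map (λ (l≢j , l≢i) → marks-other l≢i l≢j) (proj₂ (Unique⇒two-apart P j Q i R u))))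
      (≡⇒≈βη (cong₂ (λ f g → app f (app g x)) marks-j marks-i))

  word-i-j : ∀ P Q R x → Unique (P ++ i ∷ Q ++ j ∷ R) → word marks (P ++ i ∷ Q ++ j ∷ R) x ≈βη app (var 1) (app (var 0) x)
  word-i-j P Q R x u =
    ≈trans (word-two marks P i Q j R x (All.map (λ (l≢i , l≢j) → marks-other l≢i l≢j) (proj₂ (Unique⇒two-apart P i Q j R u))))
      (≡⇒≈βη (cong₂ (λ f g → app f (app g x)) marks-i marks-j))

separate : ∀ {A t₁ t₂} Θ₁ Θ₂ (N₁ : Nf [] t₁ A) (N₂ : Nf [] t₂ A) → Θ₁ ≈βη t₁ → Θ₂ ≈βη t₂ →
  Discordant (trace₀ N₁) (trace₀ N₂) →
  Σ Tm λ C → OneHole C (A [ Bool /p]) Bool × (plug C (tsub Bool Θ₁) ≈βη zero̲) × (plug C (tsub Bool Θ₂) ≈βη one̲)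
separate {A} Θ₁ Θ₂ N₁ N₂ Θ₁≈t₁ Θ₂≈t₂ (discordant i j P Q R P′ Q′ R′ w₁-split w₂-split) =
  separator A ℓ , separator-typed A ℓ (fresh⁺-unique A) i∈ j∈ ,
  ≈trans (plug-separator ℓ Θ₁ N₁ Θ₁≈t₁) (ξlam (ξlam (ξlam (≈trans (≡⇒≈βη (cong (λ w → word marks w (var 2)) w₁-split))
    (word-j-i P Q R (var 2) u₁))))) ,
  ≈trans (plug-separator ℓ Θ₂ N₂ Θ₂≈t₂) (ξlam (ξlam (ξlam (≈trans (≡⇒≈βη (cong (λ w → word marks w (var 2)) w₂-split))
    (word-i-j P′ Q′ R′ (var 2) u₂)))))
  where
  ℓ : Lab⁺ A
  ℓ = fresh⁺ A 0
  u₁ : Unique (P ++ j ∷ Q ++ i ∷ R)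
  u₁ = ≡-subst Unique w₁-split (trace₀-unique N₁)
  u₂ : Unique (P′ ++ i ∷ Q′ ++ j ∷ R′)
  u₂ = ≡-subst Unique w₂-split (trace₀-unique N₂)
  open Separator i j (proj₁ (Unique⇒two-apart P j Q i R u₁) ∘ sym)
  i∈ : i ∈ labs⁺ A ℓ
  i∈ = Any-resp-↭ (trace₀-↭ N₁) (≡-subst (i ∈_) (sym w₁-split) (∈-++⁺ʳ P (there (∈-++⁺ʳ Q (here refl)))))
  j∈ : j ∈ labs⁺ A ℓ
  j∈ = Any-resp-↭ (trace₀-↭ N₁) (≡-subst (j ∈_) (sym w₁-split) (∈-++⁺ʳ P (here refl)))

corollary5p2 : (A : Ty) (Θ₁ Θ₂ : Tm) → Closed Θ₁ A → Closed Θ₂ A → ¬ (Θ₁ ≈βη Θ₂) →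
    Σ Tm (λ C → OneHole C (A [ Bool /p]) Bool
      × (plug C (tsub Bool Θ₁) ≈βη zero̲) × (plug C (tsub Bool Θ₂) ≈βη one̲))
corollary5p2 A Θ₁ Θ₂ ⊢Θ₁ ⊢Θ₂ Θ₁≉Θ₂ with normalise ⊢Θ₁ | normalise ⊢Θ₂
... | t₁ , N₁ , Θ₁≈t₁ | t₂ , N₂ , Θ₂≈t₂ with ≡-dec _≟_ (trace₀ N₁) (trace₀ N₂)
...   | yes same-trace =
  ⊥-elim (Θ₁≉Θ₂ (≈trans Θ₁≈t₁ (≈trans (≡⇒≈βη (trace₀-injective N₁ N₂ same-trace)) (≈sym Θ₂≈t₂))))
...   | no different-traces = separate Θ₁ Θ₂ N₁ N₂ Θ₁≈t₁ Θ₂≈t₂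
  (↭-≢⇒discordant _ _ (↭-trans (trace₀-↭ N₁) (↭-sym (trace₀-↭ N₂))) different-traces)
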